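{- For every $N\ge1$, the prefix tree for $\mathrm{Av}_N(321)$ is isomorphic to the prefix tree for $\mathrm{Av}_N(312)$: there is a bijection $\Phi$ from the set of prefixes for $\mathrm{Av}_N(321)$ to the set of prefixes for $\mathrm{Av}_N(312)$ which preserves the tree structure (i.e. $p$ is a prefix flattening of $q$ if and only if $\Phi(p)$ is a prefix flattening of $\Phi(q)$) and preserves strike probabilities, $S_N(\Phi(p))=S_N(p)$ as pairs of integers.
   Context: For a pattern $\rho$ (a permutation of $[M]$), $\mathrm{Av}_N(\rho)$ is the set of permutations $\pi=\pi_1\cdots\pi_N$ of $[N]$ with no subsequence $\pi_{i_1}\cdots\pi_{i_M}$ ($i_1<\dots<i_M$) in the same relative order as $\rho$. The $i$th prefix flattening $\pi|_{[i]}$ is the permutation of $[i]$ in the same relative order as $\pi_1,\dots,\pi_i$. For a set $I_N$ of permutations of $[N]$, a prefix is a permutation $p$ of $[k]$, $1\le k\le N$, with $p=\pi|_{[k]}$ for some $\pi\in I_N$; a prefix $q$ has $p$ (of size $k$) as a prefix flattening if $q|_{[k]}=p$; the prefix tree is the set of prefixes ordered by this relation. The strike probability of a prefix $p$ of size $k$ is the pair of integers $S_N(p)=\big(\#\{\pi\in I_N:\pi|_{[k]}=p,\ \pi_k=N\},\ \#\{\pi\in I_N:\pi|_{[k]}=p\}\big)$. -}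

module Defs where

open import Data.Bool using (Bool; true; false; _∧_; _∨_; not; T; if_then_else_)
open import Data.Nat using (ℕ; zero; suc; _∸_; _≡ᵇ_; _<ᵇ_)
open import Data.List using (List; []; _∷_; map; length; take; drop; applyUpTo; concatMap; _++_)

anyB : {A : Set} → (A → Bool) → List A → Bool
anyB f [] = false
anyB f (x ∷ xs) = f x ∨ anyB f xs

allB : {A : Set} → (A → Bool) → List A → Bool
allB f [] = true
allB f (x ∷ xs) = f x ∧ allB f xs

filterB : {A : Set} → (A → Bool) → List A → List A
filterB f [] = []
filterB f (x ∷ xs) = if f x then x ∷ filterB f xs else filterB f xs

countB : {A : Set} → (A → Bool) → List A → ℕ
countB f xs = length (filterB f xs)
open import Data.Product using (Σ; _×_; _,_)

_==L_ : List ℕ → List ℕ → Bool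
[] ==L [] = true
(x ∷ xs) ==L (y ∷ ys) = (x ≡ᵇ y) ∧ (xs ==L ys)
_ ==L _ = false

memB : ℕ → List ℕ → Bool
memB x xs = anyB (λ y → x ≡ᵇ y) xs

range1 : ℕ → List ℕ
range1 n = applyUpTo suc n

isPerm : ℕ → List ℕ → Bool
isPerm n l = (length l ≡ᵇ n) ∧ allB (λ i → memB i l) (range1 n)

words : ℕ → ℕ → List (List ℕ)
words zero    n = [] ∷ []
words (suc m) n = concatMap (λ x → map (x ∷_) (words m n)) (range1 n)

perms : ℕ → List (List ℕ)
perms n = filterB (λ l → isPerm n l) (words n n)

flatten : List ℕ → List ℕ
flatten xs = map (λ x → suc (countB (λ y → y <ᵇ x) xs)) xs

subseqs : List ℕ → List (List ℕ)
subseqs [] = [] ∷ []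
subseqs (x ∷ xs) = map (x ∷_) (subseqs xs) ++ subseqs xs

containsB : List ℕ → List ℕ → Bool
containsB ρ π = anyB (λ σ → flatten σ ==L ρ) (subseqs π)

Av : ℕ → List ℕ → List (List ℕ)
Av N ρ = filterB (λ π → not (containsB ρ π)) (perms N)

prefixFlat : ℕ → List ℕ → List ℕ
prefixFlat i π = flatten (take i π)

isPrefix : ℕ → List ℕ → List ℕ → Bool
isPrefix N ρ p = anyB (λ π → anyB (λ k → prefixFlat k π ==L p) (range1 N)) (Av N ρ)

Prefix : ℕ → List ℕ → Set
Prefix N ρ = Σ (List ℕ) (λ p → T (isPrefix N ρ p))

isPrefixFlatOf : List ℕ → List ℕ → Bool
isPrefixFlatOf p q = prefixFlat (length p) q ==L p

-- π_k = N  (1-based position k)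
entryIs : ℕ → List ℕ → ℕ → Bool
entryIs zero π N = false
entryIs (suc k) π N with drop k π
... | [] = false
... | x ∷ _ = x ≡ᵇ N

strike : ℕ → List ℕ → List ℕ → ℕ × ℕ
strike N ρ p =
  ( countB (λ π → (prefixFlat k π ==L p) ∧ entryIs k π N) (Av N ρ)
  , countB (λ π → prefixFlat k π ==L p) (Av N ρ) )
  where
  k = length p

pat321 : List ℕ
pat321 = 3 ∷ 2 ∷ 1 ∷ []

pat312 : List ℕ
pat312 = 3 ∷ 1 ∷ 2 ∷ []

-- A permutation is encoded by its ranks read from right to left: the code x ∷ r stands for the
-- permutation decode r followed by a new last entry of rank x (the earlier entries ≥ x are bumped
-- up by one).  In this encoding the prefix flattenings of a permutation are the decodings of the
-- suffixes of its code, and its k-th entry is the maximum iff the k-th code entry is a new maximum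
-- and no later one is.
--
-- Pattern avoidance becomes a condition on each new code entry.  A rank x can be appended to a
-- 321-avoider iff x is a new maximum or x exceeds the largest entry m that was not a new maximum;
-- for 312 the admissible ranks form an explicit decreasing list headed by the new maximum.  For
-- corresponding codes both classes admit the same number of ranks, so pairing them off in order
-- gives a length-preserving bijection to312 between the two sets of codes which commutes with
-- taking suffixes and preserves new maxima.  Transporting prefixes along it gives Φ, and the strike
-- counts agree because the same transport is a bijection Av_N(321) → Av_N(312) compatible with
-- prefix flattening and with the position of N.

module Submission where

open import Defs
open import Data.Bool using (Bool; true; false; T; _∧_; _∨_; not; if_then_else_)
open import Data.Bool.Properties using (T-∧; T-∨; T-≡; T-not-≡; ⇔→≡; T-irrelevant; ∧-zeroʳ)
open import Data.Empty using (⊥-elim)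
open import Data.List using (List; []; _∷_; [_]; map; length; _++_; take; drop; reverse; concat; initLast; _∷ʳ′_)
open import Data.List.Properties
  using (map-∘; map-cong; map-++; map-id-local; map-injective; length-map; length-drop; length-++-sucʳ;
         ∷-injective; ∷ʳ-injective; ++-conicalʳ; take-map; drop-map; take-all; drop-all; reverse-++; reverse-map)
open import Data.List.Membership.Propositional using (_∈_; _∉_)
open import Data.List.Membership.Propositional.Properties
  using (∈-map⁺; ∈-map⁻; ∈-++⁺ˡ; ∈-++⁺ʳ; ∈-++⁻; ∈-∃++; ∈-applyUpTo⁺; ∈-applyUpTo⁻;
         ∈-concat⁺′; ∈-concat⁻′)
open import Data.List.Membership.Propositional.Properties.WithK using (unique∧set⇒bag)
open import Data.List.Relation.Binary.BagAndSetEquality using (∼bag⇒↭)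
open import Data.List.Relation.Binary.Permutation.Propositional as Perm using (_↭_; ↭-sym; ↭⇒↭ₛ)
open import Data.List.Relation.Binary.Permutation.Propositional.Properties
  using (shift; ++-comm; ↭-length; ↭-reverse; ∈-resp-↭)
open import Data.List.Relation.Binary.Sublist.Propositional using (_⊆_; []; _∷_; _∷ʳ_; ⊆-refl; to∈; from∈)
open import Data.List.Relation.Binary.Sublist.Propositional.Properties using (++⁺; ++⁺ʳ; Any-resp-⊆; drop-⊆)
  renaming (map⁺ to ⊆-map⁺)
open import Data.List.Relation.Unary.All as All using (All)
open import Data.List.Relation.Unary.All.Properties using (¬Any⇒All¬) renaming (map⁺ to All-map⁺)
open import Data.List.Relation.Unary.AllPairs using (AllPairs; []; _∷_)
open import Data.List.Relation.Unary.Any using (here; there)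
open import Data.List.Relation.Unary.Unique.Propositional using (Unique)
open import Data.List.Relation.Unary.Unique.Propositional.Properties using (applyUpTo⁺₁) renaming (++⁺ to Unique-++⁺)
open import Data.Nat using (ℕ; zero; suc; pred; _+_; _∸_; _≡ᵇ_; _<ᵇ_; _≤ᵇ_; _≤_; _<_; _>_; z≤n; s≤s)
open import Data.Nat.Properties
  using (_≟_; _<?_; _≤?_; <ᵇ⇒<; <⇒<ᵇ; ≤ᵇ⇒≤; ≤⇒≤ᵇ; ≡ᵇ⇒≡; ≡⇒≡ᵇ; ≤-refl; ≤-reflexive; ≤-trans; ≤-antisym;
         ≤-pred; <-trans; <-irrefl; <-asym; <-cmp; ≤-<-trans; <-≤-trans; <⇒≤; <⇒≢; <⇒≱; ≮⇒≥; ≰⇒>; ≤∧≢⇒<;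
         suc-injective; n≤1+n; m≤n⇒m≤1+n; m<n⇒m<1+n; m≤n⇒m<n∨m≡n; +-assoc; +-comm; +-identityʳ; +-monoʳ-<;
         +-cancelʳ-<; +-∸-assoc; m∸n+n≡m; m+[n∸m]≡n; m+n∸m≡n; m∸[m∸n]≡n; m∸n≤m; m∸n≡0⇒m≤n; n∸n≡0;
         ∸-monoˡ-<)
open import Data.List.Membership.DecPropositional _≟_ using (_∈?_)
open import Data.Product using (Σ; ∃; ∃₂; _×_; _,_; proj₁; proj₂; map₁)
open import Data.Sum using (_⊎_; inj₁; inj₂)
open import Data.Unit using (⊤; tt)
open import Function using (_∘_; _∘′_; id)
open import Function.Bundles using (Equivalence; _⇔_; mk⇔)
open import Function.Definitions using (Bijective; Injective; Surjective)
open import Relation.Binary.Core using (_Preserves_⟶_)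
open import Relation.Binary.Definitions using (tri<; tri≈; tri>)
open import Relation.Binary.PropositionalEquality
  using (_≡_; _≢_; refl; sym; trans; cong; cong₂; subst; subst₂; setoid; module ≡-Reasoning)
open import Data.List.Relation.Binary.Permutation.Setoid.Properties (setoid ℕ) using (Unique-resp-↭)
open import Relation.Nullary using (¬_; yes; no)

module _ {a b : Bool} where

  T-∧⁻ : T (a ∧ b) → T a × T b
  T-∧⁻ = Equivalence.to T-∧

  T-∧⁺ : T a → T b → T (a ∧ b)
  T-∧⁺ p q = Equivalence.from T-∧ (p , q)

  T-∨⁻ : T (a ∨ b) → T a ⊎ T b
  T-∨⁻ = Equivalence.to T-∨

  T-∨⁺ : T a ⊎ T b → T (a ∨ b)
  T-∨⁺ = Equivalence.from T-∨

T-not⁻ : ∀ {a} → T (not a) → ¬ T a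
T-not⁻ {false} _ ()

T-not⁺ : ∀ {a} → ¬ T a → T (not a)
T-not⁺ {true} ¬t = ¬t tt
T-not⁺ {false} _ = tt

T⇒≡true : ∀ {a} → T a → a ≡ true
T⇒≡true = Equivalence.to T-≡

≡true⇒T : ∀ {a} → a ≡ true → T a
≡true⇒T = Equivalence.from T-≡

¬T⇒≡false : ∀ {a} → ¬ T a → a ≡ false
¬T⇒≡false = Equivalence.to T-not-≡ ∘ T-not⁺

T-injective : ∀ {a b} → (T a → T b) → (T b → T a) → a ≡ b
T-injective f g = ⇔→≡ {z = true} (mk⇔ (T⇒≡true ∘ f ∘ ≡true⇒T) (T⇒≡true ∘ g ∘ ≡true⇒T))

module _ {m n : ℕ} where

  <⇒<ᵇ≡true : m < n → (m <ᵇ n) ≡ true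
  <⇒<ᵇ≡true = T⇒≡true ∘ <⇒<ᵇ

  ≥⇒<ᵇ≡false : n ≤ m → (m <ᵇ n) ≡ false
  ≥⇒<ᵇ≡false n≤m = ¬T⇒≡false (λ t → <⇒≱ (<ᵇ⇒< m n t) n≤m)

  ≤⇒≤ᵇ≡true : m ≤ n → (m ≤ᵇ n) ≡ true
  ≤⇒≤ᵇ≡true = T⇒≡true ∘ ≤⇒≤ᵇ

  >⇒≤ᵇ≡false : n < m → (m ≤ᵇ n) ≡ false
  >⇒≤ᵇ≡false n<m = ¬T⇒≡false (λ t → <⇒≱ n<m (≤ᵇ⇒≤ m n t))

  ≡⇒≡ᵇ≡true : m ≡ n → (m ≡ᵇ n) ≡ true
  ≡⇒≡ᵇ≡true = T⇒≡true ∘ ≡⇒≡ᵇ m n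

  ≢⇒≡ᵇ≡false : m ≢ n → (m ≡ᵇ n) ≡ false
  ≢⇒≡ᵇ≡false m≢n = ¬T⇒≡false (m≢n ∘ ≡ᵇ⇒≡ m n)

module _ (m n : ℕ) where

  <ᵇ≡true⇒< : (m <ᵇ n) ≡ true → m < n
  <ᵇ≡true⇒< = <ᵇ⇒< m n ∘ ≡true⇒T

  <ᵇ≡false⇒≥ : (m <ᵇ n) ≡ false → n ≤ m
  <ᵇ≡false⇒≥ e = ≮⇒≥ (λ m<n → subst T e (<⇒<ᵇ m<n))

  ≤ᵇ≡true⇒≤ : (m ≤ᵇ n) ≡ true → m ≤ n
  ≤ᵇ≡true⇒≤ = ≤ᵇ⇒≤ m n ∘ ≡true⇒T

  ≤ᵇ≡false⇒> : (m ≤ᵇ n) ≡ false → n < m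
  ≤ᵇ≡false⇒> e = ≰⇒> (λ m≤n → subst T e (≤⇒≤ᵇ m≤n))

  ≡ᵇ≡true⇒≡ : (m ≡ᵇ n) ≡ true → m ≡ n
  ≡ᵇ≡true⇒≡ = ≡ᵇ⇒≡ m n ∘ ≡true⇒T

  ≡ᵇ≡false⇒≢ : (m ≡ᵇ n) ≡ false → m ≢ n
  ≡ᵇ≡false⇒≢ e m≡n = subst T e (≡⇒≡ᵇ m n m≡n)

module _ {A : Set} (f : A → Bool) where

  anyB⁺ : ∀ {xs x} → x ∈ xs → T (f x) → T (anyB f xs)
  anyB⁺ (here refl) t = T-∨⁺ (inj₁ t)
  anyB⁺ {y ∷ _} (there x∈) t = T-∨⁺ {f y} (inj₂ (anyB⁺ x∈ t))

  anyB⁻ : ∀ xs → T (anyB f xs) → ∃ λ x → x ∈ xs × T (f x)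
  anyB⁻ (x ∷ xs) t with T-∨⁻ {f x} t
  ... | inj₁ fx = x , here refl , fx
  ... | inj₂ rest with anyB⁻ xs rest
  ...   | y , y∈ , fy = y , there y∈ , fy

  allB⁺ : ∀ xs → (∀ {x} → x ∈ xs → T (f x)) → T (allB f xs)
  allB⁺ [] _ = tt
  allB⁺ (x ∷ xs) h = T-∧⁺ (h (here refl)) (allB⁺ xs (h ∘ there))

  allB⁻ : ∀ {xs x} → T (allB f xs) → x ∈ xs → T (f x)
  allB⁻ {y ∷ _} t (here refl) = proj₁ (T-∧⁻ {f y} t)
  allB⁻ {y ∷ _} t (there x∈) = allB⁻ (proj₂ (T-∧⁻ {f y} t)) x∈

  ∈-filterB⁺ : ∀ {xs x} → x ∈ xs → T (f x) → x ∈ filterB f xs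
  ∈-filterB⁺ {y ∷ _} (here refl) t with f y
  ... | true = here refl
  ∈-filterB⁺ {y ∷ _} (there x∈) t with f y
  ... | true = there (∈-filterB⁺ x∈ t)
  ... | false = ∈-filterB⁺ x∈ t

  ∈-filterB⁻ : ∀ xs {x} → x ∈ filterB f xs → x ∈ xs × T (f x)
  ∈-filterB⁻ (y ∷ xs) x∈ with f y in fy
  ∈-filterB⁻ (y ∷ xs) (here refl) | true = here refl , ≡true⇒T fy
  ∈-filterB⁻ (y ∷ xs) (there x∈) | true = map₁ there (∈-filterB⁻ xs x∈)
  ∈-filterB⁻ (y ∷ xs) x∈ | false = map₁ there (∈-filterB⁻ xs x∈)

  AllPairs-filterB⁺ : ∀ {R : A → A → Set} {xs} → AllPairs R xs → AllPairs R (filterB f xs)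
  AllPairs-filterB⁺ [] = []
  AllPairs-filterB⁺ {xs = x ∷ xs} (Rx ∷ Rxs) with f x
  ... | true = All.tabulate (All.lookup Rx ∘ proj₁ ∘ ∈-filterB⁻ xs) ∷ AllPairs-filterB⁺ Rxs
  ... | false = AllPairs-filterB⁺ Rxs

  countB-∷-true : ∀ x xs → f x ≡ true → countB f (x ∷ xs) ≡ suc (countB f xs)
  countB-∷-true _ _ fx rewrite fx = refl

  countB-∷-false : ∀ x xs → f x ≡ false → countB f (x ∷ xs) ≡ countB f xs
  countB-∷-false _ _ fx rewrite fx = refl

  countB-↭ : ∀ {xs ys} → xs ↭ ys → countB f xs ≡ countB f ys
  countB-↭ Perm.refl = refl
  countB-↭ (Perm.prep x p) with f x
  ... | true = cong suc (countB-↭ p)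
  ... | false = countB-↭ p
  countB-↭ (Perm.swap x y p) with f x | f y
  ... | true | true = cong (suc ∘ suc) (countB-↭ p)
  ... | true | false = cong suc (countB-↭ p)
  ... | false | true = cong suc (countB-↭ p)
  ... | false | false = countB-↭ p
  countB-↭ (Perm.trans p q) = trans (countB-↭ p) (countB-↭ q)

countB-cong : ∀ {A : Set} (f g : A → Bool) xs → (∀ {x} → x ∈ xs → f x ≡ g x) → countB f xs ≡ countB g xs
countB-cong f g [] _ = refl
countB-cong f g (x ∷ xs) h with f x | g x | h (here refl)
... | true | .true | refl = cong suc (countB-cong f g xs (h ∘ there))
... | false | .false | refl = countB-cong f g xs (h ∘ there)

countB-map : ∀ {A B : Set} (f : B → Bool) (g : A → B) xs → countB f (map g xs) ≡ countB (f ∘ g) xs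
countB-map f g [] = refl
countB-map f g (x ∷ xs) with f (g x)
... | true = cong suc (countB-map f g xs)
... | false = countB-map f g xs

Unique-map⁺ : ∀ {A B : Set} (h : A → B) {xs} → (∀ {a b} → a ∈ xs → b ∈ xs → h a ≡ h b → a ≡ b) →
  Unique xs → Unique (map h xs)
Unique-map⁺ h inj [] = []
Unique-map⁺ h inj (x≢xs ∷ u) =
  All-map⁺ (All.tabulate (λ y∈ e → All.lookup x≢xs y∈ (inj (here refl) (there y∈) e)))
  ∷ Unique-map⁺ h (λ a∈ b∈ → inj (there a∈) (there b∈)) u

countB-bijection : ∀ {A B : Set} (h : A → B) {as : List A} {bs : List B} → Unique as → Unique bs →
  (∀ {a} → a ∈ as → h a ∈ bs) →
  (∀ {a a′} → a ∈ as → a′ ∈ as → h a ≡ h a′ → a ≡ a′) →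
  (∀ {b} → b ∈ bs → ∃ λ a → a ∈ as × h a ≡ b) →
  (P : B → Bool) → countB P bs ≡ countB (P ∘ h) as
countB-bijection h {as} {bs} uas ubs into inj onto P =
  trans
    (sym (countB-↭ P (∼bag⇒↭ (unique∧set⇒bag (Unique-map⁺ h inj uas) ubs (mk⇔ to from)))))
    (countB-map P h as)
  where
  to : ∀ {b} → b ∈ map h as → b ∈ bs
  to b∈ with ∈-map⁻ h b∈
  ... | a , a∈ , refl = into a∈
  from : ∀ {b} → b ∈ bs → b ∈ map h as
  from b∈ with onto b∈
  ... | a , a∈ , refl = ∈-map⁺ h a∈

==L⇒≡ : ∀ l l′ → T (l ==L l′) → l ≡ l′
==L⇒≡ [] [] _ = refl
==L⇒≡ (x ∷ l) (y ∷ l′) t with T-∧⁻ {x ≡ᵇ y} t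
... | x≡y , l≡l′ = cong₂ _∷_ (≡ᵇ⇒≡ x y x≡y) (==L⇒≡ l l′ l≡l′)

==L-refl : ∀ l → T (l ==L l)
==L-refl [] = tt
==L-refl (x ∷ l) = T-∧⁺ (≡⇒≡ᵇ x x refl) (==L-refl l)

∈⇒memB : ∀ {x xs} → x ∈ xs → T (memB x xs)
∈⇒memB {x} x∈ = anyB⁺ (x ≡ᵇ_) x∈ (≡⇒≡ᵇ x x refl)

memB⇒∈ : ∀ {x} xs → T (memB x xs) → x ∈ xs
memB⇒∈ {x} xs t with anyB⁻ (x ≡ᵇ_) xs t
... | y , y∈ , x≡y = subst (_∈ xs) (sym (≡ᵇ⇒≡ x y x≡y)) y∈

-- Order-preserving maps and bumping

module _ {f : ℕ → ℕ} (mono : f Preserves _<_ ⟶ _<_) where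

  strictMono-reflects-< : ∀ {a b} → f a < f b → a < b
  strictMono-reflects-< {a} {b} fa<fb with <-cmp a b
  ... | tri< a<b _ _ = a<b
  ... | tri≈ _ refl _ = ⊥-elim (<-irrefl refl fa<fb)
  ... | tri> _ _ b<a = ⊥-elim (<-asym fa<fb (mono b<a))

  strictMono-injective : ∀ {a b} → f a ≡ f b → a ≡ b
  strictMono-injective {a} {b} fa≡fb with <-cmp a b
  ... | tri< a<b _ _ = ⊥-elim (<-irrefl fa≡fb (mono a<b))
  ... | tri≈ _ a≡b _ = a≡b
  ... | tri> _ _ b<a = ⊥-elim (<-irrefl (sym fa≡fb) (mono b<a))

  strictMono-<ᵇ : ∀ a b → (f a <ᵇ f b) ≡ (a <ᵇ b)
  strictMono-<ᵇ a b = T-injective (<⇒<ᵇ ∘ strictMono-reflects-< ∘ <ᵇ⇒< (f a) (f b))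
                                  (<⇒<ᵇ ∘ mono ∘ <ᵇ⇒< a b)

  flatten-map : ∀ l → flatten (map f l) ≡ flatten l
  flatten-map l = trans (sym (map-∘ l)) (map-cong rank-map l)
    where
    rank-map : ∀ z → suc (countB (_<ᵇ f z) (map f l)) ≡ suc (countB (_<ᵇ z) l)
    rank-map z = cong suc (trans (countB-map (_<ᵇ f z) f l)
                                 (countB-cong _ _ l (λ {y} _ → strictMono-<ᵇ y z)))

bump : ℕ → ℕ → ℕ
bump x y = if x ≤ᵇ y then suc y else y

bump-view : ∀ x y → (y < x × bump x y ≡ y) ⊎ (x ≤ y × bump x y ≡ suc y)
bump-view x y with x ≤ᵇ y in x≤ᵇy
... | true = inj₂ (≤ᵇ≡true⇒≤ x y x≤ᵇy , refl)
... | false = inj₁ (≤ᵇ≡false⇒> x y x≤ᵇy , refl)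

bump-< : ∀ {x y} → y < x → bump x y ≡ y
bump-< {x} {y} y<x with bump-view x y
... | inj₁ (_ , e) = e
... | inj₂ (x≤y , _) = ⊥-elim (<-irrefl refl (<-≤-trans y<x x≤y))

bump-≥ : ∀ {x y} → x ≤ y → bump x y ≡ suc y
bump-≥ {x} {y} x≤y with bump-view x y
... | inj₁ (y<x , _) = ⊥-elim (<-irrefl refl (<-≤-trans y<x x≤y))
... | inj₂ (_ , e) = e

bump-mono-< : ∀ x → bump x Preserves _<_ ⟶ _<_
bump-mono-< x {a} {b} a<b with bump-view x a | bump-view x b
... | inj₁ (_ , ea) | inj₁ (_ , eb) rewrite ea | eb = a<b
... | inj₁ (_ , ea) | inj₂ (_ , eb) rewrite ea | eb = m<n⇒m<1+n a<b
... | inj₂ (x≤a , _) | inj₁ (b<x , _) = ⊥-elim (<-asym a<b (<-≤-trans b<x x≤a))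
... | inj₂ (_ , ea) | inj₂ (_ , eb) rewrite ea | eb = s≤s a<b

bump-injective : ∀ x {a b} → bump x a ≡ bump x b → a ≡ b
bump-injective x = strictMono-injective (bump-mono-< x)

bump-cancel-< : ∀ x {a b} → bump x a < bump x b → a < b
bump-cancel-< x = strictMono-reflects-< (bump-mono-< x)

≤bump : ∀ x y → y ≤ bump x y
≤bump x y with bump-view x y
... | inj₁ (_ , e) rewrite e = ≤-refl
... | inj₂ (_ , e) rewrite e = n≤1+n y

bump≤ : ∀ x y → bump x y ≤ suc y
bump≤ x y with bump-view x y
... | inj₁ (_ , e) rewrite e = n≤1+n y
... | inj₂ (_ , e) rewrite e = ≤-refl

bump-above⁺ : ∀ {x y} → x ≤ y → x < bump x y
bump-above⁺ x≤y rewrite bump-≥ x≤y = s≤s x≤y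

bump-above⁻ : ∀ x y → x < bump x y → x ≤ y
bump-above⁻ x y x<b with bump-view x y
... | inj₁ (y<x , e) = ⊥-elim (<-asym y<x (subst (x <_) e x<b))
... | inj₂ (x≤y , _) = x≤y

bump-below⁺ : ∀ {x y} → y < x → bump x y < x
bump-below⁺ y<x rewrite bump-< y<x = y<x

bump-below⁻ : ∀ x y → bump x y < x → y < x
bump-below⁻ x y b<x = ≤-<-trans (≤bump x y) b<x

unbump : ℕ → ℕ → ℕ
unbump x y = if x <ᵇ y then pred y else y

bump-unbump : ∀ x y → y ≢ x → bump x (unbump x y) ≡ y
bump-unbump x y y≢x with x <ᵇ y in x<ᵇy
bump-unbump x (suc y) _ | true = bump-≥ (≤-pred (<ᵇ≡true⇒< x (suc y) x<ᵇy))
... | false = bump-< (≤∧≢⇒< (<ᵇ≡false⇒≥ x y x<ᵇy) y≢x)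

unbump-range : ∀ {x y k} → 1 ≤ x → x ≤ suc k → 1 ≤ y → y ≤ suc k → y ≢ x → 1 ≤ unbump x y × unbump x y ≤ k
unbump-range {x} {y} x≥1 x≤ y≥1 y≤ y≢x with x <ᵇ y in x<ᵇy
unbump-range {x} {suc y} x≥1 x≤ y≥1 y≤ y≢x | true = ≤-trans x≥1 (≤-pred (<ᵇ≡true⇒< x (suc y) x<ᵇy)) , ≤-pred y≤
... | false = y≥1 , ≤-pred (<-≤-trans (≤∧≢⇒< (<ᵇ≡false⇒≥ x y x<ᵇy) y≢x) x≤)

-- Pattern occurrences and appending a rank

∈-subseqs⁺ : ∀ {σ π} → σ ⊆ π → σ ∈ subseqs π
∈-subseqs⁺ [] = here refl
∈-subseqs⁺ {x ∷ _} (refl ∷ s) = ∈-++⁺ˡ (∈-map⁺ (x ∷_) (∈-subseqs⁺ s))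
∈-subseqs⁺ {π = y ∷ π} (y ∷ʳ s) = ∈-++⁺ʳ (map (y ∷_) (subseqs π)) (∈-subseqs⁺ s)

∈-subseqs⁻ : ∀ {σ} π → σ ∈ subseqs π → σ ⊆ π
∈-subseqs⁻ [] (here refl) = []
∈-subseqs⁻ (x ∷ π) σ∈ with ∈-++⁻ (map (x ∷_) (subseqs π)) σ∈
... | inj₂ σ∈π = x ∷ʳ ∈-subseqs⁻ π σ∈π
... | inj₁ σ∈xπ with ∈-map⁻ (x ∷_) σ∈xπ
...   | _ , τ∈ , refl = refl ∷ ∈-subseqs⁻ π τ∈

containsB⁻ : ∀ ρ π → T (containsB ρ π) → ∃ λ σ → σ ⊆ π × flatten σ ≡ ρ
containsB⁻ ρ π t with anyB⁻ (λ σ → flatten σ ==L ρ) (subseqs π) t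
... | σ , σ∈ , eq = σ , ∈-subseqs⁻ π σ∈ , ==L⇒≡ (flatten σ) ρ eq

containsB⁺ : ∀ {ρ σ π} → σ ⊆ π → flatten σ ≡ ρ → T (containsB ρ π)
containsB⁺ {σ = σ} s refl = anyB⁺ (λ τ → flatten τ ==L flatten σ) (∈-subseqs⁺ s) (==L-refl (flatten σ))

⊆-map⁻ : ∀ {A B : Set} (f : A → B) {σ} π → σ ⊆ map f π → ∃ λ τ → σ ≡ map f τ × τ ⊆ π
⊆-map⁻ f [] [] = [] , refl , []
⊆-map⁻ f (x ∷ π) (refl ∷ s) with ⊆-map⁻ f π s
... | τ , refl , s′ = x ∷ τ , refl , refl ∷ s′
⊆-map⁻ f (x ∷ π) (_ ∷ʳ s) with ⊆-map⁻ f π s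
... | τ , refl , s′ = τ , refl , x ∷ʳ s′

⊆-snoc⁻ : ∀ {A : Set} {σ} (xs : List A) y → σ ⊆ xs ++ [ y ] → σ ⊆ xs ⊎ ∃ λ τ → σ ≡ τ ++ [ y ] × τ ⊆ xs
⊆-snoc⁻ [] y (refl ∷ []) = inj₂ ([] , refl , [])
⊆-snoc⁻ [] y (y ∷ʳ []) = inj₁ []
⊆-snoc⁻ (x ∷ xs) y (refl ∷ s) with ⊆-snoc⁻ xs y s
... | inj₁ s′ = inj₁ (refl ∷ s′)
... | inj₂ (τ , refl , s′) = inj₂ (x ∷ τ , refl , refl ∷ s′)
⊆-snoc⁻ (x ∷ xs) y (x ∷ʳ s) with ⊆-snoc⁻ xs y s
... | inj₁ s′ = inj₁ (x ∷ʳ s′)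
... | inj₂ (τ , refl , s′) = inj₂ (τ , refl , x ∷ʳ s′)

module _ (f : ℕ → Bool) {x y z : ℕ} where

  countB₃≡2 : f x ≡ false → countB f (x ∷ y ∷ z ∷ []) ≡ 2 → f y ≡ true × f z ≡ true
  countB₃≡2 fx e with f x | f y | f z
  countB₃≡2 () e | true | _ | _
  countB₃≡2 fx e | false | true | true = refl , refl
  countB₃≡2 fx () | false | true | false
  countB₃≡2 fx () | false | false | true
  countB₃≡2 fx () | false | false | false

  countB₃≡1 : f x ≡ false → f y ≡ false → countB f (x ∷ y ∷ z ∷ []) ≡ 1 → f z ≡ true
  countB₃≡1 fx fy e with f x | f y | f z
  countB₃≡1 () fy e | true | _ | _
  countB₃≡1 fx () e | false | true | _
  countB₃≡1 fx fy e | false | false | true = refl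
  countB₃≡1 fx fy () | false | false | false

<ᵇ-irrefl : ∀ n → (n <ᵇ n) ≡ false
<ᵇ-irrefl n = ≥⇒<ᵇ≡false {n} {n} ≤-refl

flatten≡321⁺ : ∀ {a b c} → c < b → b < a → flatten (a ∷ b ∷ c ∷ []) ≡ pat321
flatten≡321⁺ {a} {b} {c} c<b b<a
  rewrite <ᵇ-irrefl a | <ᵇ-irrefl b | <ᵇ-irrefl c
        | <⇒<ᵇ≡true b<a | <⇒<ᵇ≡true c<b | <⇒<ᵇ≡true (<-trans c<b b<a)
        | ≥⇒<ᵇ≡false (<⇒≤ b<a) | ≥⇒<ᵇ≡false (<⇒≤ c<b) | ≥⇒<ᵇ≡false (<⇒≤ (<-trans c<b b<a)) = refl

flatten≡312⁺ : ∀ {a b c} → b < c → c < a → flatten (a ∷ b ∷ c ∷ []) ≡ pat312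
flatten≡312⁺ {a} {b} {c} b<c c<a
  rewrite <ᵇ-irrefl a | <ᵇ-irrefl b | <ᵇ-irrefl c
        | <⇒<ᵇ≡true c<a | <⇒<ᵇ≡true b<c | <⇒<ᵇ≡true (<-trans b<c c<a)
        | ≥⇒<ᵇ≡false (<⇒≤ c<a) | ≥⇒<ᵇ≡false (<⇒≤ b<c) | ≥⇒<ᵇ≡false (<⇒≤ (<-trans b<c c<a)) = refl

flatten≡321⁻ : ∀ {a b c} → flatten (a ∷ b ∷ c ∷ []) ≡ pat321 → c < b × b < a
flatten≡321⁻ {a} {b} {c} e = <ᵇ≡true⇒< c b c<ᵇb , <ᵇ≡true⇒< b a b<ᵇa
  where
  rank-a : countB (_<ᵇ a) (a ∷ b ∷ c ∷ []) ≡ 2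
  rank-a = suc-injective (proj₁ (∷-injective e))
  rank-b : countB (_<ᵇ b) (a ∷ b ∷ c ∷ []) ≡ 1
  rank-b = suc-injective (proj₁ (∷-injective (proj₂ (∷-injective e))))
  b<ᵇa = proj₁ (countB₃≡2 (_<ᵇ a) (<ᵇ-irrefl a) rank-a)
  c<ᵇb = countB₃≡1 (_<ᵇ b) (≥⇒<ᵇ≡false (<⇒≤ (<ᵇ≡true⇒< b a b<ᵇa))) (<ᵇ-irrefl b) rank-b

flatten≡312⁻ : ∀ {a b c} → flatten (a ∷ b ∷ c ∷ []) ≡ pat312 → b < c × c < a
flatten≡312⁻ {a} {b} {c} e = <ᵇ≡true⇒< b c b<ᵇc , <ᵇ≡true⇒< c a c<ᵇa
  where
  rank-a : countB (_<ᵇ a) (a ∷ b ∷ c ∷ []) ≡ 2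
  rank-a = suc-injective (proj₁ (∷-injective e))
  rank-c : countB (_<ᵇ c) (a ∷ c ∷ b ∷ []) ≡ 1
  rank-c = trans (countB-↭ (_<ᵇ c) {a ∷ c ∷ b ∷ []} (Perm.prep a (Perm.swap c b Perm.refl)))
                 (suc-injective (proj₁ (∷-injective (proj₂ (∷-injective (proj₂ (∷-injective e)))))))
  c<ᵇa = proj₂ (countB₃≡2 (_<ᵇ a) (<ᵇ-irrefl a) rank-a)
  b<ᵇc = countB₃≡1 (_<ᵇ c) (≥⇒<ᵇ≡false (<⇒≤ (<ᵇ≡true⇒< c a c<ᵇa))) (<ᵇ-irrefl c) rank-c

appendRank : ℕ → List ℕ → List ℕ
appendRank x q = map (bump x) q ++ [ x ]

containsB-appendRank⁺ : ∀ ρ x q → T (containsB ρ q) → T (containsB ρ (appendRank x q))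
containsB-appendRank⁺ ρ x q t with containsB⁻ ρ q t
... | σ , σ⊆q , refl = containsB⁺ (++⁺ʳ [ x ] (⊆-map⁺ (bump x) σ⊆q)) (flatten-map (bump-mono-< x) σ)

snoc≢[] : ∀ {A : Set} (l : List A) x → l ++ [ x ] ≢ []
snoc≢[] [] x ()
snoc≢[] (_ ∷ _) x ()

containsB-appendRank⁻ : ∀ {ρ₁ ρ₂ ρ₃} x q → T (containsB (ρ₁ ∷ ρ₂ ∷ ρ₃ ∷ []) (appendRank x q)) →
  T (containsB (ρ₁ ∷ ρ₂ ∷ ρ₃ ∷ []) q) ⊎
  ∃₂ λ a b → a ∷ b ∷ [] ⊆ q × flatten (bump x a ∷ bump x b ∷ x ∷ []) ≡ ρ₁ ∷ ρ₂ ∷ ρ₃ ∷ []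
containsB-appendRank⁻ x q t with containsB⁻ _ (appendRank x q) t
... | σ , σ⊆ , eq with ⊆-snoc⁻ (map (bump x) q) x σ⊆
...   | inj₁ σ⊆′ with ⊆-map⁻ (bump x) q σ⊆′
...     | τ , refl , τ⊆q = inj₁ (containsB⁺ τ⊆q (trans (sym (flatten-map (bump-mono-< x) τ)) eq))
containsB-appendRank⁻ x q t | σ , σ⊆ , eq | inj₂ (σ′ , refl , σ′⊆) with ⊆-map⁻ (bump x) q σ′⊆
... | a ∷ b ∷ [] , refl , ab⊆q = inj₂ (a , b , ab⊆q , eq)
... | a ∷ b ∷ c ∷ τ , refl , _ =
  ⊥-elim (snoc≢[] (map _ (map (bump x) τ)) _ (trans (sym (map-++ _ (map (bump x) τ) [ x ]))
    (proj₂ (∷-injective (proj₂ (∷-injective (proj₂ (∷-injective eq))))))))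
containsB-appendRank⁻ x q t | σ , σ⊆ , () | inj₂ (σ′ , refl , σ′⊆) | [] , refl , _
containsB-appendRank⁻ x q t | σ , σ⊆ , () | inj₂ (σ′ , refl , σ′⊆) | _ ∷ [] , refl , _

Completes321 : ℕ → List ℕ → Set
Completes321 x q = ∃₂ λ a b → a ∷ b ∷ [] ⊆ q × b < a × x ≤ b

Completes312 : ℕ → List ℕ → Set
Completes312 x q = ∃₂ λ a b → a ∷ b ∷ [] ⊆ q × b < x × x ≤ a

appendRank-321⁻ : ∀ x q → T (containsB pat321 (appendRank x q)) → T (containsB pat321 q) ⊎ Completes321 x q
appendRank-321⁻ x q t with containsB-appendRank⁻ x q t
... | inj₁ t′ = inj₁ t′
... | inj₂ (a , b , ab⊆q , eq) with flatten≡321⁻ eq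
...   | x<b′ , b′<a′ = inj₂ (a , b , ab⊆q , bump-cancel-< x b′<a′ , bump-above⁻ x b x<b′)

appendRank-321⁺ : ∀ x q → Completes321 x q → T (containsB pat321 (appendRank x q))
appendRank-321⁺ x q (a , b , ab⊆q , b<a , x≤b) =
  containsB⁺ (++⁺ (⊆-map⁺ (bump x) ab⊆q) ⊆-refl) (flatten≡321⁺ (bump-above⁺ x≤b) (bump-mono-< x b<a))

appendRank-312⁻ : ∀ x q → T (containsB pat312 (appendRank x q)) → T (containsB pat312 q) ⊎ Completes312 x q
appendRank-312⁻ x q t with containsB-appendRank⁻ x q t
... | inj₁ t′ = inj₁ t′
... | inj₂ (a , b , ab⊆q , eq) with flatten≡312⁻ eq
...   | b′<x , x<a′ = inj₂ (a , b , ab⊆q , bump-below⁻ x b b′<x , bump-above⁻ x a x<a′)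

appendRank-312⁺ : ∀ x q → Completes312 x q → T (containsB pat312 (appendRank x q))
appendRank-312⁺ x q (a , b , ab⊆q , b<x , x≤a) =
  containsB⁺ (++⁺ (⊆-map⁺ (bump x) ab⊆q) ⊆-refl) (flatten≡312⁺ (bump-below⁺ b<x) (bump-above⁺ x≤a))

pair-appendRank⁻ : ∀ {a′ b′} x q → a′ ∷ b′ ∷ [] ⊆ appendRank x q →
  (∃₂ λ a b → a ∷ b ∷ [] ⊆ q × a′ ≡ bump x a × b′ ≡ bump x b) ⊎ (∃ λ a → a ∈ q × a′ ≡ bump x a × b′ ≡ x)
pair-appendRank⁻ x q s with ⊆-snoc⁻ (map (bump x) q) x s
... | inj₁ s′ with ⊆-map⁻ (bump x) q s′
...   | a ∷ b ∷ [] , refl , ab⊆q = inj₁ (a , b , ab⊆q , refl , refl)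
...   | [] , () , _
...   | _ ∷ [] , () , _
...   | _ ∷ _ ∷ _ ∷ _ , () , _
pair-appendRank⁻ x q s | inj₂ (c ∷ [] , refl , s′) with ⊆-map⁻ (bump x) q s′
... | a ∷ [] , refl , a⊆q = inj₂ (a , to∈ a⊆q , refl , refl)
pair-appendRank⁻ x q s | inj₂ ([] , () , _)
pair-appendRank⁻ x q s | inj₂ (_ ∷ _ ∷ τ , e , _) = ⊥-elim (snoc≢[] τ x (sym (proj₂ (∷-injective (proj₂ (∷-injective e))))))

pair-appendRank-old : ∀ {a b} x q → a ∷ b ∷ [] ⊆ q → bump x a ∷ bump x b ∷ [] ⊆ appendRank x q
pair-appendRank-old x q ab⊆q = ++⁺ʳ [ x ] (⊆-map⁺ (bump x) ab⊆q)

pair-appendRank-new : ∀ {a} x q → a ∈ q → bump x a ∷ x ∷ [] ⊆ appendRank x q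
pair-appendRank-new x q a∈q = ++⁺ (⊆-map⁺ (bump x) (from∈ a∈q)) ⊆-refl

-- Rank codes

IsCode : List ℕ → Set
IsCode [] = ⊤
IsCode (x ∷ r) = IsCode r × 1 ≤ x × x ≤ suc (length r)

decode : List ℕ → List ℕ
decode [] = []
decode (x ∷ r) = appendRank x (decode r)

length-appendRank : ∀ x q → length (appendRank x q) ≡ suc (length q)
length-appendRank x q = trans (↭-length (++-comm (map (bump x) q) [ x ])) (cong suc (length-map (bump x) q))

length-decode : ∀ r → length (decode r) ≡ length r
length-decode [] = refl
length-decode (x ∷ r) = trans (length-appendRank x (decode r)) (cong suc (length-decode r))

∈-appendRank⁻ : ∀ {a} x q → a ∈ appendRank x q → (∃ λ b → b ∈ q × a ≡ bump x b) ⊎ a ≡ x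
∈-appendRank⁻ x q a∈ with ∈-++⁻ (map (bump x) q) a∈
... | inj₁ a∈q = inj₁ (∈-map⁻ (bump x) a∈q)
... | inj₂ (here a≡x) = inj₂ a≡x

decode-range : ∀ r → IsCode r → ∀ {a} → a ∈ decode r → 1 ≤ a × a ≤ length r
decode-range (x ∷ r) (code , x≥1 , x≤) a∈ with ∈-appendRank⁻ x (decode r) a∈
... | inj₂ refl = x≥1 , x≤
... | inj₁ (b , b∈ , refl) with decode-range r code b∈
...   | b≥1 , b≤ = ≤-trans b≥1 (≤bump x b) , ≤-trans (bump≤ x b) (s≤s b≤)

decode-complete : ∀ r → IsCode r → ∀ {a} → 1 ≤ a → a ≤ length r → a ∈ decode r
decode-complete [] _ {suc _} _ ()
decode-complete (x ∷ r) (code , x≥1 , x≤) {a} a≥1 a≤ with <-cmp a x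
... | tri≈ _ refl _ = ∈-++⁺ʳ (map (bump x) (decode r)) (here refl)
... | tri< a<x _ _ = ∈-++⁺ˡ (subst (_∈ map (bump x) (decode r)) (bump-< a<x)
        (∈-map⁺ (bump x) (decode-complete r code a≥1 (≤-pred (≤-trans a<x x≤)))))
decode-complete (x ∷ r) (code , x≥1 , x≤) {suc a} a≥1 a≤ | tri> _ _ x<a =
  ∈-++⁺ˡ (subst (_∈ map (bump x) (decode r)) (bump-≥ (≤-pred x<a))
        (∈-map⁺ (bump x) (decode-complete r code (≤-trans x≥1 (≤-pred x<a)) (≤-pred a≤))))

bump-<ᵇ-≤ : ∀ {x y} z → y ≤ x → (bump x z <ᵇ y) ≡ (z <ᵇ y)
bump-<ᵇ-≤ {x} {y} z y≤x with bump-view x z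
... | inj₁ (_ , e) rewrite e = refl
... | inj₂ (x≤z , e) rewrite e =
  trans (≥⇒<ᵇ≡false (m≤n⇒m≤1+n (≤-trans y≤x x≤z))) (sym (≥⇒<ᵇ≡false (≤-trans y≤x x≤z)))

bump-<ᵇ-> : ∀ {x y} z → x ≤ y → (bump x z <ᵇ suc y) ≡ (z <ᵇ y)
bump-<ᵇ-> {x} {y} z x≤y with bump-view x z
... | inj₂ (_ , e) rewrite e = refl
... | inj₁ (z<x , e) rewrite e =
  trans (<⇒<ᵇ≡true (m≤n⇒m≤1+n (≤-trans z<x x≤y))) (sym (<⇒<ᵇ≡true (≤-trans z<x x≤y)))

countB-<-appendRank-≤ : ∀ {x y} q → y ≤ x → countB (_<ᵇ y) (appendRank x q) ≡ countB (_<ᵇ y) q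
countB-<-appendRank-≤ {x} {y} q y≤x = begin
  countB (_<ᵇ y) (map (bump x) q ++ [ x ])  ≡⟨ countB-↭ (_<ᵇ y) (++-comm (map (bump x) q) [ x ]) ⟩
  countB (_<ᵇ y) (x ∷ map (bump x) q)       ≡⟨ countB-∷-false (_<ᵇ y) x (map (bump x) q) (≥⇒<ᵇ≡false y≤x) ⟩
  countB (_<ᵇ y) (map (bump x) q)           ≡⟨ countB-map (_<ᵇ y) (bump x) q ⟩
  countB ((_<ᵇ y) ∘ bump x) q               ≡⟨ countB-cong _ _ q (λ {z} _ → bump-<ᵇ-≤ z y≤x) ⟩
  countB (_<ᵇ y) q                          ∎
  where open ≡-Reasoning

countB-<-appendRank-> : ∀ {x y} q → x ≤ y → countB (_<ᵇ suc y) (appendRank x q) ≡ suc (countB (_<ᵇ y) q)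
countB-<-appendRank-> {x} {y} q x≤y = begin
  countB (_<ᵇ suc y) (map (bump x) q ++ [ x ])  ≡⟨ countB-↭ (_<ᵇ suc y) (++-comm (map (bump x) q) [ x ]) ⟩
  countB (_<ᵇ suc y) (x ∷ map (bump x) q)       ≡⟨ countB-∷-true (_<ᵇ suc y) x (map (bump x) q) (<⇒<ᵇ≡true (s≤s x≤y)) ⟩
  suc (countB (_<ᵇ suc y) (map (bump x) q))     ≡⟨ cong suc (countB-map (_<ᵇ suc y) (bump x) q) ⟩
  suc (countB ((_<ᵇ suc y) ∘ bump x) q)         ≡⟨ cong suc (countB-cong _ _ q (λ {z} _ → bump-<ᵇ-> z x≤y)) ⟩
  suc (countB (_<ᵇ y) q)                        ∎
  where open ≡-Reasoning

countB-<-decode : ∀ r → IsCode r → ∀ y → y ≤ suc (length r) → countB (_<ᵇ y) (decode r) ≡ y ∸ 1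
countB-<-decode [] _ zero _ = refl
countB-<-decode [] _ (suc zero) _ = refl
countB-<-decode [] _ (suc (suc _)) (s≤s ())
countB-<-decode (x ∷ r) (code , x≥1 , x≤) y y≤ with x <ᵇ y in x<ᵇy
... | false = trans (countB-<-appendRank-≤ (decode r) y≤x) (countB-<-decode r code y (≤-trans y≤x x≤))
  where y≤x = <ᵇ≡false⇒≥ x y x<ᵇy
countB-<-decode (x ∷ r) (code , x≥1 , x≤) (suc y) y≤ | true =
  trans (countB-<-appendRank-> (decode r) x≤y)
        (trans (cong suc (countB-<-decode r code y (≤-pred y≤))) (m+[n∸m]≡n (≤-trans x≥1 x≤y)))
  where x≤y = ≤-pred (<ᵇ≡true⇒< x (suc y) x<ᵇy)

flatten-decode : ∀ r → IsCode r → flatten (decode r) ≡ decode r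
flatten-decode r code = map-id-local (All.tabulate λ {y} y∈ →
  let (y≥1 , y≤) = decode-range r code y∈
  in trans (cong suc (countB-<-decode r code y (m≤n⇒m≤1+n y≤))) (m+[n∸m]≡n y≥1))

ranks : List ℕ → List ℕ
ranks [] = []
ranks (x ∷ ys) = suc (countB (_<ᵇ x) ys) ∷ ranks ys

encode : List ℕ → List ℕ
encode p = ranks (reverse p)

ranks-map : ∀ {f} → f Preserves _<_ ⟶ _<_ → ∀ ys → ranks (map f ys) ≡ ranks ys
ranks-map mono [] = refl
ranks-map {f} mono (x ∷ ys) = cong₂ _∷_
  (cong suc (trans (countB-map (_<ᵇ f x) f ys) (countB-cong _ _ ys (λ {y} _ → strictMono-<ᵇ mono y x))))
  (ranks-map mono ys)

encode-decode : ∀ r → IsCode r → encode (decode r) ≡ r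
encode-decode [] _ = refl
encode-decode (x ∷ r) (code , x≥1 , x≤) = begin
  ranks (reverse (map (bump x) q ++ [ x ]))        ≡⟨ cong ranks (reverse-++ (map (bump x) q) [ x ]) ⟩
  ranks (x ∷ reverse (map (bump x) q))             ≡⟨ cong (ranks ∘ (x ∷_)) (sym (reverse-map (bump x) q)) ⟩
  ranks (x ∷ map (bump x) (reverse q))             ≡⟨ cong₂ _∷_ rank-x (ranks-map (bump-mono-< x) (reverse q)) ⟩
  x ∷ ranks (reverse q)                            ≡⟨ cong (x ∷_) (encode-decode r code) ⟩
  x ∷ r                                            ∎
  where
  open ≡-Reasoning
  q = decode r
  rank-x : suc (countB (_<ᵇ x) (map (bump x) (reverse q))) ≡ x
  rank-x = begin
    suc (countB (_<ᵇ x) (map (bump x) (reverse q)))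
      ≡⟨ cong suc (countB-map (_<ᵇ x) (bump x) (reverse q)) ⟩
    suc (countB ((_<ᵇ x) ∘ bump x) (reverse q))
      ≡⟨ cong suc (countB-cong _ _ (reverse q) (λ {z} _ → bump-<ᵇ-≤ {x} {x} z ≤-refl)) ⟩
    suc (countB (_<ᵇ x) (reverse q))
      ≡⟨ cong suc (countB-↭ (_<ᵇ x) (↭-reverse q)) ⟩
    suc (countB (_<ᵇ x) q)
      ≡⟨ cong suc (countB-<-decode r code x x≤) ⟩
    suc (x ∸ 1)
      ≡⟨ m+[n∸m]≡n x≥1 ⟩
    x ∎

decode-injective : ∀ r r′ → decode r ≡ decode r′ → r ≡ r′
decode-injective [] [] _ = refl
decode-injective [] (x ∷ r′) e with ++-conicalʳ (map (bump x) (decode r′)) [ x ] (sym e)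
... | ()
decode-injective (x ∷ r) [] e with ++-conicalʳ (map (bump x) (decode r)) [ x ] e
... | ()
decode-injective (x ∷ r) (x′ ∷ r′) e with ∷ʳ-injective (map (bump x) (decode r)) (map (bump x′) (decode r′)) e
... | e′ , refl = cong (x ∷_) (decode-injective r r′ (map-injective (bump-injective x) e′))

take-++ˡ : ∀ {A : Set} k (xs ys : List A) → k ≤ length xs → take k (xs ++ ys) ≡ take k xs
take-++ˡ zero xs ys _ = refl
take-++ˡ (suc k) (x ∷ xs) ys (s≤s k≤) = cong (x ∷_) (take-++ˡ k xs ys k≤)

drop-++ˡ : ∀ {A : Set} k (xs ys : List A) → k ≤ length xs → drop k (xs ++ ys) ≡ drop k xs ++ ys
drop-++ˡ zero xs ys _ = refl
drop-++ˡ (suc k) (x ∷ xs) ys (s≤s k≤) = drop-++ˡ k xs ys k≤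

drop-length-++ : ∀ {A : Set} (xs ys : List A) → drop (length xs) (xs ++ ys) ≡ ys
drop-length-++ [] ys = refl
drop-length-++ (x ∷ xs) ys = drop-length-++ xs ys

length-map-decode : ∀ x r → length (map (bump x) (decode r)) ≡ length r
length-map-decode x r = trans (length-map (bump x) (decode r)) (length-decode r)

prefixFlat-decode : ∀ r → IsCode r → ∀ k → k ≤ length r → prefixFlat k (decode r) ≡ decode (drop (length r ∸ k) r)
prefixFlat-decode [] _ zero _ = refl
prefixFlat-decode (x ∷ r) code k k≤ with m≤n⇒m<n∨m≡n k≤
... | inj₂ refl rewrite n∸n≡0 (length r) =
  trans (cong flatten (take-all (suc (length r)) (decode (x ∷ r)) (≤-reflexive (length-decode (x ∷ r)))))
        (flatten-decode (x ∷ r) code)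
... | inj₁ (s≤s k≤r) rewrite +-∸-assoc 1 k≤r = begin
  flatten (take k (map (bump x) (decode r) ++ [ x ]))   ≡⟨ cong flatten (take-++ˡ k _ [ x ] k≤∣map∣) ⟩
  flatten (take k (map (bump x) (decode r)))            ≡⟨ cong flatten (take-map k (decode r)) ⟩
  flatten (map (bump x) (take k (decode r)))            ≡⟨ flatten-map (bump-mono-< x) (take k (decode r)) ⟩
  prefixFlat k (decode r)                                ≡⟨ prefixFlat-decode r (proj₁ code) k k≤r ⟩
  decode (drop (length r ∸ k) r)                         ∎
  where
  open ≡-Reasoning
  k≤∣map∣ = subst (k ≤_) (sym (length-map-decode x r)) k≤r

isNewMax : ℕ → List ℕ → Bool
isNewMax x r = x ≡ᵇ suc (length r)

isNewMax-top : ∀ r → isNewMax (suc (length r)) r ≡ true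
isNewMax-top r = ≡⇒≡ᵇ≡true {suc (length r)} refl

isNewMax-low : ∀ {x} r → x ≤ length r → isNewMax x r ≡ false
isNewMax-low r x≤ = ≢⇒≡ᵇ≡false (λ x≡ → <-irrefl x≡ (s≤s x≤))

holdsMaxAt : ℕ → List ℕ → Bool
holdsMaxAt k [] = false
holdsMaxAt k (x ∷ r) = if k ≡ᵇ suc (length r) then isNewMax x r else (not (isNewMax x r) ∧ holdsMaxAt k r)

headIs : List ℕ → ℕ → Bool
headIs [] N = false
headIs (x ∷ _) N = x ≡ᵇ N

entryIs-headIs : ∀ k π N → entryIs (suc k) π N ≡ headIs (drop k π) N
entryIs-headIs k π N with drop k π
... | [] = refl
... | _ ∷ _ = refl

bump≡ᵇsuc : ∀ {x z n} → z ≤ n → x ≤ suc n → (bump x z ≡ᵇ suc n) ≡ (not (x ≡ᵇ suc n) ∧ (z ≡ᵇ n))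
bump≡ᵇsuc {x} {z} {n} z≤ x≤ with bump-view x z
... | inj₂ (x≤z , e) rewrite e | ≢⇒≡ᵇ≡false {x} {suc n} (λ x≡ → <-irrefl x≡ (s≤s (≤-trans x≤z z≤))) = refl
... | inj₁ (z<x , e) rewrite e | ≢⇒≡ᵇ≡false {z} {suc n} (λ z≡ → <-irrefl z≡ (s≤s z≤)) = sym (right-false z<x)
  where
  right-false : z < x → (not (x ≡ᵇ suc n) ∧ (z ≡ᵇ n)) ≡ false
  right-false z<x with z ≟ n
  ... | no z≢n rewrite ≢⇒≡ᵇ≡false z≢n = ∧-zeroʳ _
  ... | yes z≡n rewrite ≡⇒≡ᵇ≡true (≤-antisym x≤ (subst (_< x) z≡n z<x)) = refl

headIs-decode : ∀ r → IsCode r → ∀ k → k < length r → headIs (drop k (decode r)) (length r) ≡ holdsMaxAt (suc k) r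
headIs-decode (x ∷ r) code k (s≤s k≤r) with m≤n⇒m<n∨m≡n k≤r
... | inj₂ refl rewrite ≡⇒≡ᵇ≡true {suc (length r)} refl =
  cong (λ d → headIs d (suc (length r))) (subst (λ n → drop n (map (bump x) (decode r) ++ [ x ]) ≡ [ x ])
                                                (length-map-decode x r) (drop-length-++ (map (bump x) (decode r)) [ x ]))
... | inj₁ k<r rewrite ≢⇒≡ᵇ≡false {suc k} {suc (length r)} (λ e → <-irrefl (suc-injective e) k<r)
                     | drop-++ˡ k (map (bump x) (decode r)) [ x ]
                                (≤-trans (<⇒≤ k<r) (≤-reflexive (sym (length-map-decode x r))))
                     | drop-map {f = bump x} k (decode r) =
  shifted (drop k (decode r)) refl (headIs-decode r (proj₁ code) k k<r)
  where
  shifted : ∀ d → drop k (decode r) ≡ d → headIs d (length r) ≡ holdsMaxAt (suc k) r →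
    headIs (map (bump x) d ++ [ x ]) (suc (length r)) ≡ (not (isNewMax x r) ∧ holdsMaxAt (suc k) r)
  shifted [] d≡ _ = ⊥-elim (<⇒≱ k<r (subst (_≤ k) (length-decode r)
    (m∸n≡0⇒m≤n (trans (sym (length-drop k (decode r))) (cong length d≡)))))
  shifted (z ∷ d) d≡ ih = trans (bump≡ᵇsuc z≤ (proj₂ (proj₂ code))) (cong (not (isNewMax x r) ∧_) ih)
    where
    z≤ : z ≤ length r
    z≤ = proj₂ (decode-range r (proj₁ code)
                 (Any-resp-⊆ (drop-⊆ k (decode r)) (subst (z ∈_) (sym d≡) (here refl))))

entryIs-decode : ∀ r → IsCode r → ∀ k → k < length r → entryIs (suc k) (decode r) (length r) ≡ holdsMaxAt (suc k) r
entryIs-decode r code k k< = trans (entryIs-headIs k (decode r) (length r)) (headIs-decode r code k k<)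

-- Permutations

InRange : ℕ → List ℕ → Set
InRange n l = ∀ {y} → y ∈ l → 1 ≤ y × y ≤ n

IsPermutation : ℕ → List ℕ → Set
IsPermutation n l = length l ≡ n × Unique l × InRange n l

∷-Unique : ∀ {x : ℕ} {l} → x ∉ l → Unique l → Unique (x ∷ l)
∷-Unique {l = l} x∉l u = ¬Any⇒All¬ l x∉l ∷ u

covering⇒IsPermutation : ∀ n l → length l ≡ n → (∀ i → 1 ≤ i → i ≤ n → i ∈ l) → IsPermutation n l
covering⇒IsPermutation zero [] _ _ = refl , [] , λ ()
covering⇒IsPermutation (suc n) l ∣l∣≡ covers with ∈-∃++ (covers (suc n) (s≤s z≤n) ≤-refl)
... | as , bs , refl with covering⇒IsPermutation n (as ++ bs) ∣as++bs∣≡n covers′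
  where
  ∣as++bs∣≡n = suc-injective (trans (sym (length-++-sucʳ as (suc n) bs)) ∣l∣≡)
  covers′ : ∀ i → 1 ≤ i → i ≤ n → i ∈ as ++ bs
  covers′ i i≥1 i≤n with ∈-resp-↭ (shift (suc n) as bs) (covers i i≥1 (m≤n⇒m≤1+n i≤n))
  ... | here refl = ⊥-elim (<-irrefl refl i≤n)
  ... | there i∈ = i∈
... | _ , u , range =
  ∣l∣≡ ,
  Unique-resp-↭ (↭⇒↭ₛ (↭-sym (shift (suc n) as bs)))
    (∷-Unique {suc n} (λ n+1∈ → <-irrefl refl (proj₂ (range n+1∈))) u) ,
  range′
  where
  range′ : InRange (suc n) (as ++ suc n ∷ bs)
  range′ y∈ with ∈-resp-↭ (shift (suc n) as bs) y∈
  ... | here refl = s≤s z≤n , ≤-refl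
  ... | there y∈′ = proj₁ (range y∈′) , m≤n⇒m≤1+n (proj₂ (range y∈′))

decode-surjective : ∀ n l → IsPermutation n l → ∃ λ r → IsCode r × length r ≡ n × l ≡ decode r
decode-surjective zero [] _ = [] , tt , refl , refl
decode-surjective (suc n) l (∣l∣≡ , u , range) with initLast l
... | ys ∷ʳ′ x with Unique-resp-↭ (↭⇒↭ₛ (++-comm ys [ x ])) u
...   | x∉ys ∷ uys = x ∷ r , (code , x≥1 , subst (λ m → x ≤ suc m) (sym ∣r∣≡) x≤) , cong suc ∣r∣≡ , l≡
  where
  x≥1 = proj₁ (range (∈-++⁺ʳ ys (here refl)))
  x≤ = proj₂ (range (∈-++⁺ʳ ys (here refl)))
  ∣ys∣≡ : length ys ≡ n
  ∣ys∣≡ = suc-injective (trans (sym (↭-length (++-comm ys [ x ]))) ∣l∣≡)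
  y≢x : ∀ {y} → y ∈ ys → y ≢ x
  y≢x y∈ y≡x = All.lookup x∉ys y∈ (sym y≡x)
  q = map (unbump x) ys
  q-perm : IsPermutation n q
  q-perm = trans (length-map (unbump x) ys) ∣ys∣≡
         , Unique-map⁺ (unbump x) (λ a∈ b∈ e → trans (sym (bump-unbump x _ (y≢x a∈)))
                                                  (trans (cong (bump x) e) (bump-unbump x _ (y≢x b∈)))) uys
         , q-range
    where
    q-range : InRange n q
    q-range y∈ with ∈-map⁻ (unbump x) y∈
    ... | y₀ , y₀∈ , refl with range (∈-++⁺ˡ y₀∈)
    ...   | y₀≥1 , y₀≤ = unbump-range x≥1 x≤ y₀≥1 y₀≤ (y≢x y₀∈)
  rec = decode-surjective n q q-perm
  r = proj₁ rec
  code = proj₁ (proj₂ rec)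
  ∣r∣≡ = proj₁ (proj₂ (proj₂ rec))
  l≡ : ys ++ [ x ] ≡ map (bump x) (decode r) ++ [ x ]
  l≡ = cong (_++ [ x ]) (trans (sym (map-id-local (All.tabulate (bump-unbump x _ ∘ y≢x))))
                         (trans (map-∘ ys) (cong (map (bump x)) (proj₂ (proj₂ (proj₂ rec))))))

range1-∈⁻ : ∀ {i n} → i ∈ range1 n → 1 ≤ i × i ≤ n
range1-∈⁻ i∈ with ∈-applyUpTo⁻ suc i∈
... | _ , j<n , refl = s≤s z≤n , j<n

range1-∈⁺ : ∀ {i n} → 1 ≤ i → i ≤ n → i ∈ range1 n
range1-∈⁺ {suc i} _ i≤n = ∈-applyUpTo⁺ suc i≤n

isPerm⇒IsPermutation : ∀ n l → T (isPerm n l) → IsPermutation n l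
isPerm⇒IsPermutation n l t with T-∧⁻ {length l ≡ᵇ n} t
... | ∣l∣≡ , covers = covering⇒IsPermutation n l (≡ᵇ≡true⇒≡ _ _ (T⇒≡true ∣l∣≡))
  (λ i i≥1 i≤n → memB⇒∈ l (allB⁻ (λ i → memB i l) covers (range1-∈⁺ i≥1 i≤n)))

isPerm-decode : ∀ r → IsCode r → T (isPerm (length r) (decode r))
isPerm-decode r code = T-∧⁺ (≡true⇒T (≡⇒≡ᵇ≡true (length-decode r)))
  (allB⁺ (λ i → memB i (decode r)) (range1 (length r))
     (λ i∈ → let (i≥1 , i≤) = range1-∈⁻ i∈ in ∈⇒memB (decode-complete r code i≥1 i≤)))

∈-words⁺ : ∀ m n l → length l ≡ m → InRange n l → l ∈ words m n
∈-words⁺ zero n [] _ _ = here refl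
∈-words⁺ (suc m) n (y ∷ l) ∣l∣≡ range =
  ∈-concat⁺′ (∈-map⁺ (y ∷_) (∈-words⁺ m n l (suc-injective ∣l∣≡) (range ∘ there)))
             (∈-map⁺ (λ x → map (x ∷_) (words m n)) (range1-∈⁺ y≥1 y≤))
  where
  y≥1 = proj₁ (range (here refl))
  y≤ = proj₂ (range (here refl))

Unique-words : ∀ m n → Unique (words m n)
Unique-words zero n = All.[] ∷ []
Unique-words (suc m) n = prepend-Unique (range1 n) (Unique-range1 n)
  where
  W = words m n
  Unique-range1 : ∀ n → Unique (range1 n)
  Unique-range1 n = applyUpTo⁺₁ suc n (λ i<j _ e → <⇒≢ i<j (suc-injective e))
  prepend-Unique : ∀ L → Unique L → Unique (concat (map (λ x → map (x ∷_) W) L))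
  prepend-Unique [] _ = []
  prepend-Unique (x ∷ L) (x∉L ∷ uL) =
    Unique-++⁺ (Unique-map⁺ (x ∷_) (λ _ _ → proj₂ ∘ ∷-injective) (Unique-words m n)) (prepend-Unique L uL) disjoint
    where
    disjoint : ∀ {w} → w ∈ map (x ∷_) W × w ∈ concat (map (λ x → map (x ∷_) W) L) → _
    disjoint (w∈ , w∈′) with ∈-map⁻ (x ∷_) w∈ | ∈-concat⁻′ (map (λ x → map (x ∷_) W) L) w∈′
    ... | _ , _ , refl | _ , w∈″ , ws∈ with ∈-map⁻ (λ x → map (x ∷_) W) ws∈
    ...   | x′ , x′∈L , refl with ∈-map⁻ (x′ ∷_) w∈″
    ...     | _ , _ , e = All.lookup x∉L x′∈L (proj₁ (∷-injective e))

Unique-Av : ∀ N ρ → Unique (Av N ρ)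
Unique-Av N ρ = AllPairs-filterB⁺ _ (AllPairs-filterB⁺ _ (Unique-words N N))

∈-Av⁻ : ∀ N ρ {π} → π ∈ Av N ρ → IsPermutation N π × ¬ T (containsB ρ π)
∈-Av⁻ N ρ {π} π∈ with ∈-filterB⁻ (λ π → not (containsB ρ π)) (perms N) π∈
... | π∈perms , π-avoids with ∈-filterB⁻ (isPerm N) (words N N) π∈perms
...   | _ , isPerm = isPerm⇒IsPermutation N π isPerm , T-not⁻ π-avoids

∈-Av⁺ : ∀ ρ r → IsCode r → ¬ T (containsB ρ (decode r)) → decode r ∈ Av (length r) ρ
∈-Av⁺ ρ r code avoids =
  ∈-filterB⁺ (λ π → not (containsB ρ π))
    (∈-filterB⁺ (isPerm (length r))
       (∈-words⁺ (length r) (length r) (decode r) (length-decode r) (decode-range r code))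
       (isPerm-decode r code))
    (T-not⁺ avoids)

-- Codes of 321- and 312-avoiders

maxNonRecord : List ℕ → ℕ
maxNonRecord [] = 0
maxNonRecord (x ∷ r) = if isNewMax x r then maxNonRecord r else x

Code321 : List ℕ → Set
Code321 [] = ⊤
Code321 (x ∷ r) = Code321 r × (x ≡ suc (length r) ⊎ maxNonRecord r < x × x ≤ length r)

Code321⇒IsCode : ∀ r → Code321 r → IsCode r
Code321⇒IsCode [] _ = tt
Code321⇒IsCode (x ∷ r) (code , inj₁ refl) = Code321⇒IsCode r code , s≤s z≤n , ≤-refl
Code321⇒IsCode (x ∷ r) (code , inj₂ (m<x , x≤)) = Code321⇒IsCode r code , ≤-trans (s≤s z≤n) m<x , m≤n⇒m≤1+n x≤

maxNonRecord≤length : ∀ r → Code321 r → maxNonRecord r ≤ length r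
maxNonRecord≤length [] _ = z≤n
maxNonRecord≤length (x ∷ r) (code , inj₁ refl) rewrite isNewMax-top r = m≤n⇒m≤1+n (maxNonRecord≤length r code)
maxNonRecord≤length (x ∷ r) (code , inj₂ (_ , x≤)) rewrite isNewMax-low r x≤ = m≤n⇒m≤1+n x≤

Completes321⇒≤maxNonRecord : ∀ r → Code321 r → ∀ {v} → Completes321 v (decode r) → v ≤ maxNonRecord r
Completes321⇒≤maxNonRecord [] _ (_ , _ , () , _)
Completes321⇒≤maxNonRecord (x ∷ r) (code , inj₁ refl) {v} (_ , _ , s , b′<a′ , v≤b′)
  rewrite isNewMax-top r with pair-appendRank⁻ x (decode r) s
... | inj₁ (a , b , ab⊆q , refl , refl) =
  Completes321⇒≤maxNonRecord r code
    (a , b , ab⊆q , bump-cancel-< x b′<a′ , subst (v ≤_) (bump-< (s≤s b≤)) v≤b′)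
  where b≤ = proj₂ (decode-range r (Code321⇒IsCode r code) (Any-resp-⊆ ab⊆q (there (here refl))))
... | inj₂ (a , a∈q , refl , refl) =
  ⊥-elim (<-irrefl refl (≤-trans (bump-above⁻ x a b′<a′) (proj₂ (decode-range r (Code321⇒IsCode r code) a∈q))))
Completes321⇒≤maxNonRecord (x ∷ r) (code , inj₂ (m<x , x≤)) {v} (_ , _ , s , b′<a′ , v≤b′)
  rewrite isNewMax-low r x≤ with pair-appendRank⁻ x (decode r) s
... | inj₁ (a , b , ab⊆q , refl , refl) = ≤-trans (subst (v ≤_) (bump-< b<x) v≤b′) (<⇒≤ b<x)
  where
  b<x = ≤-<-trans (Completes321⇒≤maxNonRecord r code (a , b , ab⊆q , bump-cancel-< x b′<a′ , ≤-refl)) m<x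
... | inj₂ (_ , _ , refl , refl) = v≤b′

≤maxNonRecord⇒Completes321 : ∀ r → Code321 r → ∀ {v} → 1 ≤ v → v ≤ maxNonRecord r → Completes321 v (decode r)
≤maxNonRecord⇒Completes321 [] _ v≥1 v≤0 = ⊥-elim (<⇒≱ v≥1 v≤0)
≤maxNonRecord⇒Completes321 (x ∷ r) (code , inj₁ refl) v≥1 v≤m rewrite isNewMax-top r
  with ≤maxNonRecord⇒Completes321 r code v≥1 v≤m
... | a , b , ab⊆q , b<a , v≤b =
  bump x a , bump x b , pair-appendRank-old x (decode r) ab⊆q , bump-mono-< x b<a , ≤-trans v≤b (≤bump x b)
≤maxNonRecord⇒Completes321 (x ∷ r) (code , inj₂ (m<x , x≤)) v≥1 v≤x rewrite isNewMax-low r x≤ =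
  bump x (length r) , x ,
  pair-appendRank-new x (decode r)
    (decode-complete r (Code321⇒IsCode r code) (≤-trans (s≤s z≤n) (≤-trans m<x x≤)) ≤-refl) ,
  bump-above⁺ x≤ , v≤x

Code321⇒avoids : ∀ r → Code321 r → ¬ T (containsB pat321 (decode r))
Code321⇒avoids (x ∷ r) (code , c) t with appendRank-321⁻ x (decode r) t | c
... | inj₁ t′ | _ = Code321⇒avoids r code t′
... | inj₂ completes | inj₁ refl =
  <-irrefl refl (≤-trans (Completes321⇒≤maxNonRecord r code completes) (maxNonRecord≤length r code))
... | inj₂ completes | inj₂ (m<x , _) = <-irrefl refl (<-≤-trans m<x (Completes321⇒≤maxNonRecord r code completes))

avoids⇒Code321 : ∀ r → IsCode r → ¬ T (containsB pat321 (decode r)) → Code321 r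
avoids⇒Code321 [] _ _ = tt
avoids⇒Code321 (x ∷ r) (code , x≥1 , x≤) avoids = code321 , new-entry
  where
  code321 = avoids⇒Code321 r code (avoids ∘′ containsB-appendRank⁺ pat321 x (decode r))
  new-entry : x ≡ suc (length r) ⊎ maxNonRecord r < x × x ≤ length r
  new-entry with m≤n⇒m<n∨m≡n x≤
  ... | inj₂ x≡ = inj₁ x≡
  ... | inj₁ (s≤s x≤r) with maxNonRecord r <? x
  ...   | yes m<x = inj₂ (m<x , x≤r)
  ...   | no m≮x = ⊥-elim (avoids (appendRank-321⁺ x (decode r)
                      (≤maxNonRecord⇒Completes321 r code321 x≥1 (≮⇒≥ m≮x))))

admissible312 : List ℕ → List ℕ
admissible312 [] = [ 1 ]
admissible312 (x ∷ r) = suc (suc (length r)) ∷ filterB (_≤ᵇ x) (admissible312 r)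

Code312 : List ℕ → Set
Code312 [] = ⊤
Code312 (x ∷ r) = Code312 r × x ∈ admissible312 r

admissible312-range : ∀ r {s} → s ∈ admissible312 r → 1 ≤ s × s ≤ suc (length r)
admissible312-range [] (here refl) = ≤-refl , ≤-refl
admissible312-range (x ∷ r) (here refl) = s≤s z≤n , ≤-refl
admissible312-range (x ∷ r) (there s∈) with admissible312-range r (proj₁ (∈-filterB⁻ (_≤ᵇ x) (admissible312 r) s∈))
... | s≥1 , s≤ = s≥1 , m≤n⇒m≤1+n s≤

Code312⇒IsCode : ∀ r → Code312 r → IsCode r
Code312⇒IsCode [] _ = tt
Code312⇒IsCode (x ∷ r) (code , x∈) = Code312⇒IsCode r code , admissible312-range r x∈

Completes312⇒∉admissible312 : ∀ r → Code312 r → ∀ {v} → Completes312 v (decode r) → v ∉ admissible312 r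
Completes312⇒∉admissible312 [] _ (_ , _ , () , _)
Completes312⇒∉admissible312 (x ∷ r) code (a′ , _ , s , _ , v≤a′) (here refl) =
  <-irrefl refl (≤-trans v≤a′ (proj₂ (decode-range (x ∷ r) (Code312⇒IsCode (x ∷ r) code)
                                                   (Any-resp-⊆ s (here refl)))))
Completes312⇒∉admissible312 (x ∷ r) (code , _) {v} (_ , _ , s , b′<v , v≤a′) (there v∈)
  with ∈-filterB⁻ (_≤ᵇ x) (admissible312 r) v∈ | pair-appendRank⁻ x (decode r) s
... | v∈r , v≤ᵇx | inj₁ (a , b , ab⊆q , refl , refl) =
  Completes312⇒∉admissible312 r code (a , b , ab⊆q , subst (_< v) (bump-< b<x) b′<v , v≤a) v∈r
  where
  v≤x = ≤ᵇ⇒≤ v x v≤ᵇx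
  b<x = bump-below⁻ x b (<-≤-trans b′<v v≤x)
  v≤a : v ≤ a
  v≤a with x ≤? a
  ... | yes x≤a = ≤-trans v≤x x≤a
  ... | no x≰a = subst (v ≤_) (bump-< (≰⇒> x≰a)) v≤a′
... | _ , v≤ᵇx | inj₂ (_ , _ , refl , refl) = <-irrefl refl (<-≤-trans b′<v (≤ᵇ⇒≤ v x v≤ᵇx))

∉admissible312⇒Completes312 : ∀ r → Code312 r → ∀ {v} → 1 ≤ v → v ≤ suc (length r) →
  v ∉ admissible312 r → Completes312 v (decode r)
∉admissible312⇒Completes312 [] _ (s≤s z≤n) (s≤s z≤n) v∉ = ⊥-elim (v∉ (here refl))
∉admissible312⇒Completes312 (x ∷ r) (code , x∈) {v} v≥1 v≤ v∉ with m≤n⇒m<n∨m≡n v≤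
... | inj₂ refl = ⊥-elim (v∉ (here refl))
... | inj₁ (s≤s v≤r) with v ≤? x
...   | yes v≤x with ∉admissible312⇒Completes312 r code v≥1 v≤r (v∉ ∘′ there ∘′ λ v∈ → ∈-filterB⁺ (_≤ᵇ x) v∈ (≤⇒≤ᵇ v≤x))
...     | a , b , ab⊆q , b<v , v≤a =
  bump x a , bump x b , pair-appendRank-old x (decode r) ab⊆q ,
  subst (_< v) (sym (bump-< (<-≤-trans b<v v≤x))) b<v , ≤-trans v≤a (≤bump x a)
∉admissible312⇒Completes312 (x ∷ r) (code , x∈) {v} v≥1 v≤ v∉ | inj₁ (s≤s v≤r) | no v≰x =
  bump x (length r) , x ,
  pair-appendRank-new x (decode r) (decode-complete r (Code312⇒IsCode r code) (≤-trans x≥1 x≤r) ≤-refl) ,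
  x<v , subst (v ≤_) (sym (bump-≥ x≤r)) v≤r
  where
  x<v = ≰⇒> v≰x
  x≥1 = proj₁ (admissible312-range r x∈)
  x≤r = ≤-pred (≤-trans x<v v≤r)

Code312⇒avoids : ∀ r → Code312 r → ¬ T (containsB pat312 (decode r))
Code312⇒avoids (x ∷ r) (code , x∈) t with appendRank-312⁻ x (decode r) t
... | inj₁ t′ = Code312⇒avoids r code t′
... | inj₂ completes = Completes312⇒∉admissible312 r code completes x∈

avoids⇒Code312 : ∀ r → IsCode r → ¬ T (containsB pat312 (decode r)) → Code312 r
avoids⇒Code312 [] _ _ = tt
avoids⇒Code312 (x ∷ r) (code , x≥1 , x≤) avoids = code312 , new-entry
  where
  code312 = avoids⇒Code312 r code (avoids ∘′ containsB-appendRank⁺ pat312 x (decode r))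
  new-entry : x ∈ admissible312 r
  new-entry with x ∈? admissible312 r
  ... | yes x∈ = x∈
  ... | no x∉ = ⊥-elim (avoids (appendRank-312⁺ x (decode r) (∉admissible312⇒Completes312 r code312 x≥1 x≤ x∉)))

-- The bijection between the two sets of codes

nth : List ℕ → ℕ → ℕ
nth [] _ = 0
nth (s ∷ _) zero = s
nth (_ ∷ ss) (suc i) = nth ss i

indexOf : ℕ → List ℕ → ℕ
indexOf y [] = 0
indexOf y (s ∷ ss) = if y ≡ᵇ s then 0 else suc (indexOf y ss)

nth-∈ : ∀ S i → i < length S → nth S i ∈ S
nth-∈ (s ∷ _) zero _ = here refl
nth-∈ (_ ∷ ss) (suc i) (s≤s i<) = there (nth-∈ ss i i<)

nth-<-head : ∀ s ss i → AllPairs _>_ (s ∷ ss) → 1 ≤ i → i < length (s ∷ ss) → nth (s ∷ ss) i < s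
nth-<-head s ss (suc i) (s>ss ∷ _) _ (s≤s i<) = All.lookup s>ss (nth-∈ ss i i<)

filterB-all : ∀ (f : ℕ → Bool) ss → (∀ {t} → t ∈ ss → T (f t)) → filterB f ss ≡ ss
filterB-all f [] _ = refl
filterB-all f (s ∷ ss) all rewrite T⇒≡true (all (here refl)) = cong (s ∷_) (filterB-all f ss (all ∘ there))

filterB-≤nth : ∀ S i → AllPairs _>_ S → i < length S → filterB (_≤ᵇ nth S i) S ≡ drop i S
filterB-≤nth (s ∷ ss) zero (s>ss ∷ _) _ rewrite ≤⇒≤ᵇ≡true {s} ≤-refl =
  cong (s ∷_) (filterB-all _ ss (≤⇒≤ᵇ ∘ <⇒≤ ∘ All.lookup s>ss))
filterB-≤nth (s ∷ ss) (suc i) (s>ss ∷ dec) (s≤s i<) rewrite >⇒≤ᵇ≡false {s} (All.lookup s>ss (nth-∈ ss i i<)) =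
  filterB-≤nth ss i dec i<

indexOf-nth : ∀ S i → AllPairs _>_ S → i < length S → indexOf (nth S i) S ≡ i
indexOf-nth (s ∷ ss) zero _ _ rewrite ≡⇒≡ᵇ≡true {s} refl = refl
indexOf-nth (s ∷ ss) (suc i) (s>ss ∷ dec) (s≤s i<)
  rewrite ≢⇒≡ᵇ≡false {nth ss i} {s} (λ e → <-irrefl e (All.lookup s>ss (nth-∈ ss i i<))) =
  cong suc (indexOf-nth ss i dec i<)

nth-indexOf : ∀ {y} S → y ∈ S → nth S (indexOf y S) ≡ y
nth-indexOf {y} (s ∷ ss) y∈ with y ≡ᵇ s in y≡ᵇs | y∈
... | true | _ = sym (≡ᵇ≡true⇒≡ y s y≡ᵇs)
... | false | here refl = ⊥-elim (≡ᵇ≡false⇒≢ y s y≡ᵇs refl)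
... | false | there y∈ss = nth-indexOf ss y∈ss

indexOf-< : ∀ {y} S → y ∈ S → indexOf y S < length S
indexOf-< {y} (s ∷ ss) y∈ with y ≡ᵇ s in y≡ᵇs | y∈
... | true | _ = s≤s z≤n
... | false | here refl = ⊥-elim (≡ᵇ≡false⇒≢ y s y≡ᵇs refl)
... | false | there y∈ss = s≤s (indexOf-< ss y∈ss)

admissible312-decreasing : ∀ r → AllPairs _>_ (admissible312 r)
admissible312-decreasing [] = All.[] ∷ []
admissible312-decreasing (x ∷ r) =
  All.tabulate (s≤s ∘ proj₂ ∘ admissible312-range r ∘ proj₁ ∘ ∈-filterB⁻ (_≤ᵇ x) (admissible312 r))
  ∷ AllPairs-filterB⁺ _ (admissible312-decreasing r)

top∈admissible312 : ∀ r → suc (length r) ∈ admissible312 r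
top∈admissible312 [] = here refl
top∈admissible312 (_ ∷ _) = here refl

nth-admissible312-< : ∀ r i → 1 ≤ i → i < length (admissible312 r) → nth (admissible312 r) i < suc (length r)
nth-admissible312-< [] (suc i) _ (s≤s ())
nth-admissible312-< (x ∷ r) i i≥1 i< = nth-<-head _ _ i (admissible312-decreasing (x ∷ r)) i≥1 i<

ℓ+m≡1+k⇒x∸m<ℓ : ∀ {ℓ m x k} → ℓ + m ≡ suc k → m < x → x ≤ k → x ∸ m < ℓ
ℓ+m≡1+k⇒x∸m<ℓ {ℓ} {m} {x} ℓ+m≡ m<x x≤k =
  +-cancelʳ-< m (x ∸ m) ℓ (subst₂ _<_ (sym (m∸n+n≡m (<⇒≤ m<x))) (sym ℓ+m≡) (s≤s x≤k))

-- A non-maximal entry x of a 321-code r is one of the ranks m+1 … |r|, m = maxNonRecord r; it is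
-- sent to the (x ∸ m)-th element of the decreasing list of admissible 312-ranks, whose 0-th element
-- is the new maximum.
mutual
  to312 : List ℕ → List ℕ
  to312 [] = []
  to312 (x ∷ r) = to312-entry x r ∷ to312 r

  to312-entry : ℕ → List ℕ → ℕ
  to312-entry x r = if isNewMax x r then suc (length r) else nth (admissible312 (to312 r)) (x ∸ maxNonRecord r)

mutual
  to321 : List ℕ → List ℕ
  to321 [] = []
  to321 (y ∷ r) = to321-entry y r ∷ to321 r

  to321-entry : ℕ → List ℕ → ℕ
  to321-entry y r = if isNewMax y r then suc (length r) else maxNonRecord (to321 r) + indexOf y (admissible312 r)

length-to312 : ∀ r → length (to312 r) ≡ length r
length-to312 [] = refl
length-to312 (x ∷ r) = cong suc (length-to312 r)

length-to321 : ∀ r → length (to321 r) ≡ length r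
length-to321 [] = refl
length-to321 (x ∷ r) = cong suc (length-to321 r)

drop-to312 : ∀ j r → drop j (to312 r) ≡ to312 (drop j r)
drop-to312 zero r = refl
drop-to312 (suc j) [] = refl
drop-to312 (suc j) (x ∷ r) = drop-to312 j r

Code321-drop : ∀ j r → Code321 r → Code321 (drop j r)
Code321-drop zero r code = code
Code321-drop (suc j) [] code = code
Code321-drop (suc j) (x ∷ r) (code , _) = Code321-drop j r code

Code312-drop : ∀ j r → Code312 r → Code312 (drop j r)
Code312-drop zero r code = code
Code312-drop (suc j) [] code = code
Code312-drop (suc j) (x ∷ r) (code , _) = Code312-drop j r code

to312-valid : ∀ r → Code321 r → Code312 (to312 r) × length (admissible312 (to312 r)) + maxNonRecord r ≡ suc (length r)
to312-valid [] _ = tt , refl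
to312-valid (x ∷ r) (code , c) with to312-valid r code
to312-valid (x ∷ r) (code , inj₁ refl) | code312 , size rewrite isNewMax-top r =
  (code312 , subst (λ n → suc n ∈ S) (length-to312 r) (top∈admissible312 (to312 r))) ,
  cong suc (trans (cong (λ S′ → length S′ + maxNonRecord r) (filterB-all _ S below-top)) size)
  where
  S = admissible312 (to312 r)
  below-top : ∀ {s} → s ∈ S → T (s ≤ᵇ suc (length r))
  below-top s∈ = ≤⇒≤ᵇ (subst (λ n → _ ≤ suc n) (length-to312 r) (proj₂ (admissible312-range (to312 r) s∈)))
to312-valid (x ∷ r) (code , inj₂ (m<x , x≤)) | code312 , size rewrite isNewMax-low r x≤ =
  (code312 , nth-∈ S i i<) , cong suc size′
  where
  open ≡-Reasoning
  S = admissible312 (to312 r)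
  decreasing = admissible312-decreasing (to312 r)
  m = maxNonRecord r
  i = x ∸ m
  i< : i < length S
  i< = ℓ+m≡1+k⇒x∸m<ℓ size m<x x≤
  size′ : length (filterB (_≤ᵇ nth S i) S) + x ≡ suc (length r)
  size′ = begin
    length (filterB (_≤ᵇ nth S i) S) + x  ≡⟨ cong (λ S′ → length S′ + x) (filterB-≤nth S i decreasing i<) ⟩
    length (drop i S) + x                 ≡⟨ cong (_+ x) (length-drop i S) ⟩
    (length S ∸ i) + x                    ≡⟨ cong ((length S ∸ i) +_) (sym (m∸n+n≡m (<⇒≤ m<x))) ⟩
    (length S ∸ i) + (i + m)              ≡⟨ sym (+-assoc (length S ∸ i) i m) ⟩
    (length S ∸ i) + i + m                ≡⟨ cong (_+ m) (m∸n+n≡m (<⇒≤ i<)) ⟩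
    length S + m                          ≡⟨ size ⟩
    suc (length r)                        ∎

to312-index< : ∀ r → Code321 r → ∀ {x} → maxNonRecord r < x → x ≤ length r →
  x ∸ maxNonRecord r < length (admissible312 (to312 r))
to312-index< r code = ℓ+m≡1+k⇒x∸m<ℓ (proj₂ (to312-valid r code))

isNewMax-to312 : ∀ x r → Code321 (x ∷ r) → isNewMax (to312-entry x r) (to312 r) ≡ isNewMax x r
isNewMax-to312 x r (code , inj₁ refl) rewrite isNewMax-top r | length-to312 r = isNewMax-top r
isNewMax-to312 x r (code , inj₂ (m<x , x≤)) rewrite isNewMax-low r x≤ | length-to312 r =
  isNewMax-low {y} r (≤-pred (subst (λ n → y < suc n) (length-to312 r)
    (nth-admissible312-< (to312 r) (x ∸ maxNonRecord r) i≥1 (to312-index< r code m<x x≤))))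
  where
  y = nth (admissible312 (to312 r)) (x ∸ maxNonRecord r)
  i≥1 : 1 ≤ x ∸ maxNonRecord r
  i≥1 = subst (_< x ∸ maxNonRecord r) (n∸n≡0 (maxNonRecord r)) (∸-monoˡ-< m<x ≤-refl)

holdsMaxAt-to312 : ∀ j r → Code321 r → holdsMaxAt j (to312 r) ≡ holdsMaxAt j r
holdsMaxAt-to312 j [] _ = refl
holdsMaxAt-to312 j (x ∷ r) code
  rewrite isNewMax-to312 x r code | holdsMaxAt-to312 j r (proj₁ code) | length-to312 r = refl

to321∘to312 : ∀ r → Code321 r → to321 (to312 r) ≡ r
to321∘to312 [] _ = refl
to321∘to312 (x ∷ r) code = cong₂ _∷_ (entry code) (to321∘to312 r (proj₁ code))
  where
  entry : Code321 (x ∷ r) → to321-entry (to312-entry x r) (to312 r) ≡ x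
  entry code′ with isNewMax-to312 x r code′
  entry (_ , inj₁ refl) | e rewrite isNewMax-top r | e | length-to312 r = refl
  entry (c , inj₂ (m<x , x≤)) | e rewrite isNewMax-low r x≤ | e | to321∘to312 r c = begin
    maxNonRecord r + indexOf (nth S (x ∸ maxNonRecord r)) S
      ≡⟨ cong (maxNonRecord r +_) (indexOf-nth S _ (admissible312-decreasing (to312 r)) (to312-index< r c m<x x≤)) ⟩
    maxNonRecord r + (x ∸ maxNonRecord r)
      ≡⟨ m+[n∸m]≡n (<⇒≤ m<x) ⟩
    x ∎
    where
    open ≡-Reasoning
    S = admissible312 (to312 r)

indexOf-admissible312-pos : ∀ r {y} → y ≢ suc (length r) → 1 ≤ indexOf y (admissible312 r)
indexOf-admissible312-pos [] y≢ rewrite ≢⇒≡ᵇ≡false y≢ = s≤s z≤n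
indexOf-admissible312-pos (_ ∷ _) y≢ rewrite ≢⇒≡ᵇ≡false y≢ = s≤s z≤n

to312∘to321 : ∀ r → Code312 r → Code321 (to321 r) × to312 (to321 r) ≡ r
to312∘to321 [] _ = tt , refl
to312∘to321 (y ∷ r) (code , y∈) with to312∘to321 r code
... | code321 , inverse with isNewMax y r in newMax
...   | true rewrite ≡ᵇ≡true⇒≡ y (suc (length r)) newMax =
  (code321 , inj₁ (cong suc (sym (length-to321 r)))) , cong₂ _∷_ entry inverse
  where
  entry : to312-entry (suc (length r)) (to321 r) ≡ suc (length r)
  entry rewrite length-to321 r | isNewMax-top r = refl
...   | false = (code321 , inj₂ (m<x , x≤)) , cong₂ _∷_ entry inverse
  where
  open ≡-Reasoning
  t = to321 r
  m = maxNonRecord t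
  S = admissible312 r
  i = indexOf y S
  i≥1 : 1 ≤ i
  i≥1 = indexOf-admissible312-pos r (≡ᵇ≡false⇒≢ y (suc (length r)) newMax)
  size : length S + m ≡ suc (length r)
  size = begin
    length S + m                         ≡⟨ cong (λ r′ → length (admissible312 r′) + m) (sym inverse) ⟩
    length (admissible312 (to312 t)) + m ≡⟨ proj₂ (to312-valid t code321) ⟩
    suc (length t)                       ≡⟨ cong suc (length-to321 r) ⟩
    suc (length r)                       ∎
  m<x : m < m + i
  m<x = subst (_< m + i) (+-identityʳ m) (+-monoʳ-< m i≥1)
  x≤ : m + i ≤ length t
  x≤ = subst (m + i ≤_) (sym (length-to321 r))
         (≤-pred (subst (m + i <_) (trans (+-comm m (length S)) size) (+-monoʳ-< m (indexOf-< S y∈))))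
  entry : to312-entry (m + i) t ≡ y
  entry rewrite isNewMax-low t x≤ = begin
    nth (admissible312 (to312 t)) (m + i ∸ m) ≡⟨ cong₂ nth (cong admissible312 inverse) (m+n∸m≡n m i) ⟩
    nth S i                                    ≡⟨ nth-indexOf S y∈ ⟩
    y                                          ∎

-- Prefixes of a pattern class, via codes

padWithMax : ℕ → List ℕ → List ℕ
padWithMax zero r = r
padWithMax (suc j) r = suc (length (padWithMax j r)) ∷ padWithMax j r

length-padWithMax : ∀ j r → length (padWithMax j r) ≡ j + length r
length-padWithMax zero r = refl
length-padWithMax (suc j) r = cong suc (length-padWithMax j r)

drop-padWithMax : ∀ j r → drop j (padWithMax j r) ≡ r
drop-padWithMax zero r = refl
drop-padWithMax (suc j) r = drop-padWithMax j r

module CodeClass (ρ : List ℕ) (Code : List ℕ → Set)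
  (Code⇒IsCode : ∀ r → Code r → IsCode r)
  (Code⇒avoids : ∀ r → Code r → ¬ T (containsB ρ (decode r)))
  (avoids⇒Code : ∀ r → IsCode r → ¬ T (containsB ρ (decode r)) → Code r)
  (Code-drop : ∀ j r → Code r → Code (drop j r))
  (Code-newMax : ∀ r → Code r → Code (suc (length r) ∷ r)) where

  Code-padWithMax : ∀ j r → Code r → Code (padWithMax j r)
  Code-padWithMax zero r code = code
  Code-padWithMax (suc j) r code = Code-newMax (padWithMax j r) (Code-padWithMax j r code)

  ∈Av⇒code : ∀ N {π} → π ∈ Av N ρ → ∃ λ d → Code d × length d ≡ N × π ≡ decode d
  ∈Av⇒code N π∈ with ∈-Av⁻ N ρ π∈
  ... | perm , π-avoids with decode-surjective N _ perm
  ...   | d , code , ∣d∣≡N , refl = d , avoids⇒Code d code π-avoids , ∣d∣≡N , refl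

  code⇒∈Av : ∀ N d → Code d → length d ≡ N → decode d ∈ Av N ρ
  code⇒∈Av _ d code refl = ∈-Av⁺ ρ d (Code⇒IsCode d code) (Code⇒avoids d code)

  isPrefix⇒code : ∀ N p → T (isPrefix N ρ p) → ∃ λ r → Code r × 1 ≤ length r × length r ≤ N × p ≡ decode r
  isPrefix⇒code N p t with anyB⁻ (λ π → anyB (λ k → prefixFlat k π ==L p) (range1 N)) (Av N ρ) t
  ... | π , π∈ , t′ with anyB⁻ (λ k → prefixFlat k π ==L p) (range1 N) t′
  ...   | k , k∈ , eq with ∈Av⇒code N π∈ | range1-∈⁻ k∈
  ...     | d , code , refl , refl | k≥1 , k≤ =
    drop (length d ∸ k) d , Code-drop (length d ∸ k) d code ,
    subst (1 ≤_) (sym ∣r∣≡k) k≥1 , subst (_≤ length d) (sym ∣r∣≡k) k≤ ,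
    trans (sym (==L⇒≡ _ p eq)) (prefixFlat-decode d (Code⇒IsCode d code) k k≤)
    where
    ∣r∣≡k : length (drop (length d ∸ k) d) ≡ k
    ∣r∣≡k = trans (length-drop (length d ∸ k) d) (m∸[m∸n]≡n k≤)

  code⇒isPrefix : ∀ N r → Code r → 1 ≤ length r → length r ≤ N → T (isPrefix N ρ (decode r))
  code⇒isPrefix N r code r≥1 r≤N =
    anyB⁺ (λ π → anyB (λ k → prefixFlat k π ==L decode r) (range1 N)) (code⇒∈Av N d code-d ∣d∣≡N)
      (anyB⁺ (λ k → prefixFlat k (decode d) ==L decode r) (range1-∈⁺ r≥1 r≤N)
        (subst (λ l → T (l ==L decode r)) (sym prefix-r) (==L-refl (decode r))))
    where
    j = N ∸ length r
    d = padWithMax j r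
    code-d = Code-padWithMax j r code
    ∣d∣≡N : length d ≡ N
    ∣d∣≡N = trans (length-padWithMax j r) (m∸n+n≡m r≤N)
    prefix-r : prefixFlat (length r) (decode d) ≡ decode r
    prefix-r = trans (prefixFlat-decode d (Code⇒IsCode d code-d) (length r) (subst (length r ≤_) (sym ∣d∣≡N) r≤N))
                     (cong decode (trans (cong (λ n → drop (n ∸ length r) d) ∣d∣≡N) (drop-padWithMax j r)))

Suffix : List ℕ → List ℕ → Set
Suffix c d = ∃ λ j → drop j d ≡ c

prefixFlat⇒Suffix : ∀ c d → IsCode d → T (isPrefixFlatOf (decode c) (decode d)) → Suffix c d
prefixFlat⇒Suffix c d code t with length c ≤? length d
... | yes c≤d = length d ∸ length c , decode-injective _ c (begin
  decode (drop (length d ∸ length c) d)        ≡⟨ sym (prefixFlat-decode d code (length c) c≤d) ⟩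
  prefixFlat (length c) (decode d)             ≡⟨ cong (λ n → prefixFlat n (decode d)) (sym (length-decode c)) ⟩
  prefixFlat (length (decode c)) (decode d)    ≡⟨ ==L⇒≡ _ (decode c) t ⟩
  decode c                                     ∎)
  where open ≡-Reasoning
... | no c≰d = 0 , decode-injective d c (begin
  decode d                                     ≡⟨ sym (flatten-decode d code) ⟩
  flatten (decode d)                           ≡⟨ cong flatten (sym (take-all _ (decode d) ∣d∣≤∣c∣)) ⟩
  prefixFlat (length (decode c)) (decode d)    ≡⟨ ==L⇒≡ _ (decode c) t ⟩
  decode c                                     ∎)
  where
  open ≡-Reasoning
  ∣d∣≤∣c∣ = subst₂ _≤_ (sym (length-decode d)) (sym (length-decode c)) (<⇒≤ (≰⇒> c≰d))

Suffix⇒prefixFlat : ∀ c d → IsCode d → Suffix c d → T (isPrefixFlatOf (decode c) (decode d))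
Suffix⇒prefixFlat c d code (j , refl) with j ≤? length d
... | yes j≤d = subst (λ l → T (l ==L decode (drop j d))) (sym prefix-drop) (==L-refl (decode (drop j d)))
  where
  prefix-drop : prefixFlat (length (decode (drop j d))) (decode d) ≡ decode (drop j d)
  prefix-drop = trans (cong (λ n → prefixFlat n (decode d)) (trans (length-decode (drop j d)) (length-drop j d)))
                (trans (prefixFlat-decode d code (length d ∸ j) (m∸n≤m (length d) j))
                       (cong (λ n → decode (drop n d)) (m∸[m∸n]≡n j≤d)))
... | no j≰d rewrite drop-all j d (<⇒≤ (≰⇒> j≰d)) = _

module Class321 = CodeClass pat321 Code321 Code321⇒IsCode Code321⇒avoids avoids⇒Code321 Code321-drop
                            (λ _ code → code , inj₁ refl)
module Class312 = CodeClass pat312 Code312 Code312⇒IsCode Code312⇒avoids avoids⇒Code312 Code312-drop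
                            (λ r code → code , top∈admissible312 r)

Suffix-to312⁺ : ∀ c d → Suffix c d → Suffix (to312 c) (to312 d)
Suffix-to312⁺ c d (j , refl) = j , drop-to312 j d

Suffix-to312⁻ : ∀ c d → Code321 c → Code321 d → Suffix (to312 c) (to312 d) → Suffix c d
Suffix-to312⁻ c d code-c code-d (j , e) = j , (begin
  drop j d                    ≡⟨ sym (to321∘to312 (drop j d) (Code321-drop j d code-d)) ⟩
  to321 (to312 (drop j d))    ≡⟨ cong to321 (trans (sym (drop-to312 j d)) e) ⟩
  to321 (to312 c)             ≡⟨ to321∘to312 c code-c ⟩
  c                           ∎)
  where open ≡-Reasoning

-- Transport of prefixes

to312-Code312 : ∀ r → Code321 r → Code312 (to312 r)
to312-Code312 r = proj₁ ∘ to312-valid r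

to312-IsCode : ∀ r → Code321 r → IsCode (to312 r)
to312-IsCode r = Code312⇒IsCode (to312 r) ∘ to312-Code312 r

transport : List ℕ → List ℕ
transport = decode ∘ to312 ∘ encode

transport-decode : ∀ r → IsCode r → transport (decode r) ≡ decode (to312 r)
transport-decode r = cong (decode ∘ to312) ∘ encode-decode r

transport-injective : ∀ c d → Code321 c → Code321 d → transport (decode c) ≡ transport (decode d) → c ≡ d
transport-injective c d code-c code-d e = begin
  c                    ≡⟨ sym (to321∘to312 c code-c) ⟩
  to321 (to312 c)      ≡⟨ cong to321 (decode-injective _ _ (trans (sym (transport-decode c (Code321⇒IsCode c code-c)))
                                                           (trans e (transport-decode d (Code321⇒IsCode d code-d))))) ⟩
  to321 (to312 d)      ≡⟨ to321∘to312 d code-d ⟩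
  d                    ∎
  where open ≡-Reasoning

transport-prefixFlat : ∀ c d → Code321 c → Code321 d →
  isPrefixFlatOf (transport (decode c)) (transport (decode d)) ≡ isPrefixFlatOf (decode c) (decode d)
transport-prefixFlat c d code-c code-d
  rewrite transport-decode c (Code321⇒IsCode c code-c) | transport-decode d (Code321⇒IsCode d code-d) =
  T-injective
    (Suffix⇒prefixFlat c d (Code321⇒IsCode d code-d) ∘ Suffix-to312⁻ c d code-c code-d
                                                    ∘ prefixFlat⇒Suffix _ _ (to312-IsCode d code-d))
    (Suffix⇒prefixFlat _ _ (to312-IsCode d code-d) ∘ Suffix-to312⁺ c d
                                                  ∘ prefixFlat⇒Suffix c d (Code321⇒IsCode d code-d))

length-transport-decode : ∀ r → IsCode r → length (transport (decode r)) ≡ length (decode r)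
length-transport-decode r code = begin
  length (transport (decode r))   ≡⟨ cong length (transport-decode r code) ⟩
  length (decode (to312 r))       ≡⟨ length-decode (to312 r) ⟩
  length (to312 r)                ≡⟨ length-to312 r ⟩
  length r                        ≡⟨ sym (length-decode r) ⟩
  length (decode r)               ∎
  where open ≡-Reasoning

transport-entryIs : ∀ d → Code321 d → ∀ {k} → 1 ≤ k → k ≤ length d →
  entryIs k (transport (decode d)) (length d) ≡ entryIs k (decode d) (length d)
transport-entryIs d code {suc k} _ k< = begin
  entryIs (suc k) (transport (decode d)) (length d)
    ≡⟨ cong (λ π → entryIs (suc k) π (length d)) (transport-decode d (Code321⇒IsCode d code)) ⟩
  entryIs (suc k) (decode (to312 d)) (length d)
    ≡⟨ cong (entryIs (suc k) (decode (to312 d))) (sym (length-to312 d)) ⟩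
  entryIs (suc k) (decode (to312 d)) (length (to312 d))
    ≡⟨ entryIs-decode (to312 d) (to312-IsCode d code) k (subst (k <_) (sym (length-to312 d)) k<) ⟩
  holdsMaxAt (suc k) (to312 d)
    ≡⟨ holdsMaxAt-to312 (suc k) d code ⟩
  holdsMaxAt (suc k) d
    ≡⟨ sym (entryIs-decode d (Code321⇒IsCode d code) k k<) ⟩
  entryIs (suc k) (decode d) (length d) ∎
  where open ≡-Reasoning

Prefix-≡ : ∀ {N ρ} {p q : Prefix N ρ} → proj₁ p ≡ proj₁ q → p ≡ q
Prefix-≡ {p = p , t} {q = .p , u} refl = cong (p ,_) (T-irrelevant t u)

transport-isPrefix : ∀ N p → T (isPrefix N pat321 p) → T (isPrefix N pat312 (transport p))
transport-isPrefix N p t with Class321.isPrefix⇒code N p t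
... | c , code , c≥1 , c≤N , refl =
  subst (T ∘ isPrefix N pat312) (sym (transport-decode c (Code321⇒IsCode c code)))
    (Class312.code⇒isPrefix N (to312 c) (to312-Code312 c code)
      (subst (1 ≤_) (sym (length-to312 c)) c≥1) (subst (_≤ N) (sym (length-to312 c)) c≤N))

Φ : ∀ N → Prefix N pat321 → Prefix N pat312
Φ N (p , t) = transport p , transport-isPrefix N p t

Φ-injective : ∀ N → Injective _≡_ _≡_ (Φ N)
Φ-injective N {p , t} {q , u} e with Class321.isPrefix⇒code N p t | Class321.isPrefix⇒code N q u
... | c , code-c , _ , _ , refl | d , code-d , _ , _ , refl =
  Prefix-≡ {N} {pat321} (cong decode (transport-injective c d code-c code-d (cong proj₁ e)))

Φ-surjective : ∀ N → Surjective _≡_ _≡_ (Φ N)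
Φ-surjective N (p′ , t′) with Class312.isPrefix⇒code N p′ t′
... | c′ , code′ , c′≥1 , c′≤N , refl =
  (decode c , Class321.code⇒isPrefix N c code321 c≥1 c≤N) , λ { refl → Prefix-≡ {N} {pat312} Φc≡c′ }
  where
  c = to321 c′
  code321 = proj₁ (to312∘to321 c′ code′)
  c≥1 = subst (1 ≤_) (sym (length-to321 c′)) c′≥1
  c≤N = subst (_≤ N) (sym (length-to321 c′)) c′≤N
  Φc≡c′ : transport (decode c) ≡ decode c′
  Φc≡c′ = trans (transport-decode c (Code321⇒IsCode c code321)) (cong decode (proj₂ (to312∘to321 c′ code′)))

Φ-isPrefixFlatOf : ∀ N (p q : Prefix N pat321) →
  T (isPrefixFlatOf (proj₁ p) (proj₁ q)) ⇔ T (isPrefixFlatOf (proj₁ (Φ N p)) (proj₁ (Φ N q)))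
Φ-isPrefixFlatOf N (p , t) (q , u) with Class321.isPrefix⇒code N p t | Class321.isPrefix⇒code N q u
... | c , code-c , _ , _ , refl | d , code-d , _ , _ , refl rewrite transport-prefixFlat c d code-c code-d = mk⇔ id id

transport-∈Av : ∀ N {π} → π ∈ Av N pat321 → transport π ∈ Av N pat312
transport-∈Av N π∈ with Class321.∈Av⇒code N π∈
... | d , code , ∣d∣≡N , refl = subst (_∈ Av N pat312) (sym (transport-decode d (Code321⇒IsCode d code)))
  (Class312.code⇒∈Av N (to312 d) (to312-Code312 d code) (trans (length-to312 d) ∣d∣≡N))

transport-injective-Av : ∀ N {π π′} → π ∈ Av N pat321 → π′ ∈ Av N pat321 → transport π ≡ transport π′ → π ≡ π′
transport-injective-Av N π∈ π′∈ e with Class321.∈Av⇒code N π∈ | Class321.∈Av⇒code N π′∈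
... | d , code , _ , refl | d′ , code′ , _ , refl = cong decode (transport-injective d d′ code code′ e)

transport-onto-Av : ∀ N {π′} → π′ ∈ Av N pat312 → ∃ λ π → π ∈ Av N pat321 × transport π ≡ π′
transport-onto-Av N π′∈ with Class312.∈Av⇒code N π′∈
... | d′ , code′ , ∣d′∣≡N , refl =
  decode (to321 d′) ,
  Class321.code⇒∈Av N (to321 d′) code321 (trans (length-to321 d′) ∣d′∣≡N) ,
  trans (transport-decode (to321 d′) (Code321⇒IsCode _ code321)) (cong decode (proj₂ (to312∘to321 d′ code′)))
  where code321 = proj₁ (to312∘to321 d′ code′)

countB-transport : ∀ N (P : List ℕ → Bool) → countB P (Av N pat312) ≡ countB (P ∘ transport) (Av N pat321)
countB-transport N = countB-bijection transport (Unique-Av N pat321) (Unique-Av N pat312)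
  (transport-∈Av N) (transport-injective-Av N) (transport-onto-Av N)

Φ-strike : ∀ N (p : Prefix N pat321) → strike N pat312 (proj₁ (Φ N p)) ≡ strike N pat321 (proj₁ p)
Φ-strike N (p , t) with Class321.isPrefix⇒code N p t
... | c , code-c , c≥1 , c≤N , refl =
  cong₂ _,_
    (trans (countB-transport N _) (countB-cong _ _ (Av N pat321) (λ π∈ → cong₂ _∧_ (prefixes π∈) (entries π∈))))
    (trans (countB-transport N _) (countB-cong _ _ (Av N pat321) prefixes))
  where
  prefixes : ∀ {π} → π ∈ Av N pat321 → isPrefixFlatOf (transport (decode c)) (transport π) ≡ isPrefixFlatOf (decode c) π
  prefixes π∈ with Class321.∈Av⇒code N π∈
  ... | d , code-d , _ , refl = transport-prefixFlat c d code-c code-d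
  entries : ∀ {π} → π ∈ Av N pat321 → entryIs (length (transport (decode c))) (transport π) N ≡ entryIs (length (decode c)) π N
  entries π∈ with Class321.∈Av⇒code N π∈
  ... | d , code-d , refl , refl
    rewrite length-transport-decode c (Code321⇒IsCode c code-c) | length-decode c = transport-entryIs d code-d c≥1 c≤N

theorem4p16 : (N : ℕ) → 1 ≤ N →
    Σ (Prefix N pat321 → Prefix N pat312) (λ Φ →
      Bijective _≡_ _≡_ Φ
      × ((p q : Prefix N pat321) →
           T (isPrefixFlatOf (proj₁ p) (proj₁ q)) ⇔ T (isPrefixFlatOf (proj₁ (Φ p)) (proj₁ (Φ q))))
      × ((p : Prefix N pat321) → strike N pat312 (proj₁ (Φ p)) ≡ strike N pat321 (proj₁ p)))
theorem4p16 N _ = Φ N , (Φ-injective N , Φ-surjective N) , Φ-isPrefixFlatOf N , Φ-strike N
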